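{- For every matroid $M$, the polynomial $Z_M(t)$ is palindromic of degree $\operatorname{rk} M$, that is, $$t^{\operatorname{rk} M}Z_M(t^{ -1}) = Z_M(t).$$
   Context: Let $M$ be a matroid on a finite ground set $\mathcal{I}$ with lattice of flats $L$, and write $\hat 0$ for the minimal flat (the closure of the empty set). For a flat $F$, the localization $M_F$ is the matroid on ground set $F$ whose lattice of flats is $\{G\in L : G\le F\}$, and the contraction $M^F$ is the matroid on $\mathcal{I}\smallsetminus F$ whose lattice of flats is isomorphic to $\{G\in L: G\ge F\}$. Set $\operatorname{rk} F := \operatorname{rk} M_F$ and $\operatorname{crk} F := \operatorname{rk} M - \operatorname{rk} F$. Let $\mu$ be the Möbius function of $L$ and $\chi_M(t)=\sum_{F}\mu(\hat 0,F)t^{\operatorname{crk} F}$ the characteristic polynomial. The Kazhdan–Lusztig polynomial $P_M(t)\in\mathbb{Z}[t]$ is the unique assignment of a polynomial to every matroid such that: $P_M(t)=1$ if $\operatorname{rk} M=0$; $\deg P_M(t)<\tfrac12\operatorname{rk} M$ if $\operatorname{rk} M>0$; and $t^{\operatorname{rk} M}P_M(t^{ -1})=\sum_{F\in L}\chi_{M_F}(t)P_{M^F}(t)$ for every $M$. The $Z$-polynomial is $Z_M(t):=\sum_{F\in L} t^{\operatorname{rk} F}P_{M^F}(t)$. -}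

module Defs where

open import Data.Nat as ℕ using (ℕ; zero; suc; _∸_; _≤_; _<_)
open import Data.Integer as ℤ using (ℤ; 0ℤ; 1ℤ)
open import Data.Bool using (Bool; true; false; if_then_else_; _∧_; not)
open import Data.List using (List; []; _∷_; map; filter; foldr; upTo; allFin; _++_)
open import Data.Vec using (Vec; []; _∷_; tabulate)
open import Data.Fin using (Fin)
open import Data.Fin.Subset using (Subset; _∪_; _∩_; _⊆_; ∣_∣; ⁅_⁆; ⊥; ⊤; _∈_; ∁)
open import Data.Fin.Subset.Properties using (_⊆?_; _∈?_)
open import Relation.Nullary.Decidable using (does; ⌊_⌋)
open import Relation.Binary.PropositionalEquality using (_≡_)
import Data.Vec.Properties
import Data.Bool

RankFn : ℕ → Set
RankFn n = Subset n → ℕ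

record IsMatroid {n : ℕ} (ρ : RankFn n) : Set where
  field
    bounded    : ∀ X → ρ X ≤ ∣ X ∣
    monotone   : ∀ X Y → X ⊆ Y → ρ X ≤ ρ Y
    submodular : ∀ X Y → ρ (X ∪ Y) ℕ.+ ρ (X ∩ Y) ≤ ρ X ℕ.+ ρ Y

allSubsets : ∀ n → List (Subset n)
allSubsets zero    = [] ∷ []
allSubsets (suc n) = map (true ∷_) (allSubsets n) ++ map (false ∷_) (allSubsets n)

module _ {n : ℕ} (ρ : RankFn n) where

  rank : ℕ
  rank = ρ ⊤

  cl : Subset n → Subset n
  cl X = tabulate λ e → ρ (X ∪ ⁅ e ⁆) ℕ.≡ᵇ ρ X

  isFlat : Subset n → Bool
  isFlat X = foldr (λ e b → (does (e ∈? X) Data.Bool.∨ not (ρ (X ∪ ⁅ e ⁆) ℕ.≡ᵇ ρ X)) ∧ b)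
                   true (allFin n)

  flats : List (Subset n)
  flats = filter (λ X → Data.Bool.T? (isFlat X)) (allSubsets n)

  bot : Subset n
  bot = cl ⊥

  -- Möbius function of the lattice of flats (order = inclusion),
  -- via μ(F,F) = 1, μ(F,G) = - Σ_{F ≤ H < G} μ(F,H), μ(F,G) = 0 if F ≰ G.
  -- The fuel bounds chain length; suc n is always enough.
  mobiusF : ℕ → Subset n → Subset n → ℤ
  mobiusF zero    F G = 0ℤ
  mobiusF (suc k) F G with does (F ⊆? G)
  ... | false = 0ℤ
  ... | true with does (Data.Vec.Properties.≡-dec Data.Bool._≟_ F G)
  ...   | true  = 1ℤ
  ...   | false = ℤ.- foldr ℤ._+_ 0ℤ
            (map (mobiusF k F)
              (filter (λ H → Data.Bool.T? (does (F ⊆? H) ∧ does (H ⊆? G)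
                                 ∧ not (does (Data.Vec.Properties.≡-dec Data.Bool._≟_ H G))))
                      flats))

  mobius : Subset n → Subset n → ℤ
  mobius = mobiusF (suc n)

  -- localization M_F : the matroid ρ(X ∩ F); its lattice of flats is
  -- isomorphic to {G ∈ L : G ≤ F} (elements outside F become loops).
  loc : Subset n → RankFn n
  loc F X = ρ (X ∩ F)

  -- contraction M^F : the matroid ρ(X ∪ F) - ρ(F); its lattice of flats is
  -- {G ∈ L : G ≥ F} (elements of F become loops).
  con : Subset n → RankFn n
  con F X = ρ (X ∪ F) ∸ ρ F

  rk : Subset n → ℕ
  rk F = ρ F

  crk : Subset n → ℕ
  crk F = rank ∸ ρ F

-- Polynomials in ℤ[t], as coefficient sequences (only finitely many nonzero
-- coefficients ever arise).

Poly : Set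
Poly = ℕ → ℤ

_+P_ : Poly → Poly → Poly
(p +P q) i = p i ℤ.+ q i

_*P_ : Poly → Poly → Poly
(p *P q) i = foldr ℤ._+_ 0ℤ (map (λ j → p j ℤ.* q (i ∸ j)) (upTo (suc i)))

zeroP : Poly
zeroP _ = 0ℤ

oneP : Poly
oneP zero    = 1ℤ
oneP (suc _) = 0ℤ

monoP : ℤ → ℕ → Poly
monoP c k i = if i ℕ.≡ᵇ k then c else 0ℤ

sumP : {A : Set} → List A → (A → Poly) → Poly
sumP xs f = foldr _+P_ zeroP (map f xs)

charPoly : ∀ {n} → RankFn n → Poly
charPoly ρ = sumP (flats ρ) λ F → monoP (mobius ρ (bot ρ) F) (crk ρ F)

-- Writing R_M(t) = Σ_{F ∈ L, F ≠ 0̂} χ_{M_F}(t) P_{M^F}(t), the defining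
-- identity reads t^{rk M} P_M(t^{-1}) = P_M(t) + R_M(t) (the F = 0̂ term is
-- P_{M^{0̂}} = P_M, since M^{0̂} has the same rank function as M). Comparing
-- coefficients of t^i with 2i < rk M (where the left side vanishes) forces
-- [t^i] P_M = - [t^i] R_M, and deg P_M < rk M / 2 forces all other
-- coefficients to vanish; P_M = 1 if rk M = 0.  The fuel argument bounds the
-- recursion depth (rank strictly drops under contraction by F ≠ 0̂);
-- fuel suc (rk M) suffices.

klF : ℕ → ∀ {n} → RankFn n → Poly
klF zero    ρ = zeroP
klF (suc k) ρ with rank ρ ℕ.≡ᵇ 0
... | true  = oneP
... | false = λ i → if (2 ℕ.* i) ℕ.<ᵇ rank ρ then ℤ.- R i else 0ℤ
  where
  R : Poly
  R = sumP (filter (λ F → Data.Bool.T? (not (does (Data.Vec.Properties.≡-dec Data.Bool._≟_ F (bot ρ))))) (flats ρ))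
           λ F → charPoly (loc ρ F) *P klF k (con ρ F)

KL : ∀ {n} → RankFn n → Poly
KL ρ = klF (suc (rank ρ)) ρ

Zpoly : ∀ {n} → RankFn n → Poly
Zpoly ρ = sumP (flats ρ) λ F → monoP 1ℤ (rk ρ F) *P KL (con ρ F)

-- Write d F = rk M - rk F for a flat F, P_F for the Kazhdan–Lusztig polynomial of the
-- contraction M^F, and κ_FG for the characteristic polynomial of the interval [F, G].
-- The defining recursion only fixes the coefficients of P_F below degree d F / 2, where
-- P_F = -R_F with R_F = ∑_{G > F} κ_FG P_G. By induction on d F,
--   t^(d F) P_F(t⁻¹) = ∑_{G ≥ F} κ_FG(t) P_G(t):
-- this amounts to t^(d F) R_F(t⁻¹) = -R_F(t), which follows from the induction hypothesis
-- for the flats G > F because the reversed kernel κ̄_FG(t) = t^(rk G - rk F) κ_FG(t⁻¹) is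
-- inverse to κ in the incidence algebra of the lattice of flats. Summing over F,
--   t^(rk M) Z_M(t⁻¹) = ∑_{F ≤ G} κ_FG(t) P_G(t) = ∑_G t^(rk G) P_G(t) = Z_M(t),
-- as ∑_{F ≤ G} κ_FG = t^(rk G) by Möbius inversion. The top coefficient of Z_M is the
-- contribution 1 of the flat ⊤.

module Submission where

open import Data.Nat as ℕ using (ℕ; zero; suc; _∸_; _≤_; _<_; _≤?_; s≤s)
import Data.Nat.Properties as ℕP
open import Data.Nat.Tactic.RingSolver using (solve-∀)
open import Data.Integer as ℤ using (ℤ; 0ℤ; 1ℤ; -_; _+_; _*_)
import Data.Integer.Properties as ℤP
import Data.Integer.Tactic.RingSolver as ℤ-Solver
open import Data.Bool as Bool using (Bool; true; false; T; _∧_; _∨_; not; if_then_else_)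
import Data.Bool.Properties as BoolP
open import Data.List using (List; []; _∷_; _++_; map; filter; foldr; upTo; allFin)
import Data.List.Properties as ListP
import Data.List.Membership.Propositional as ListM
import Data.List.Membership.Propositional.Properties as ListMP
open import Data.List.Relation.Unary.Any using (here; there)
open import Data.Fin using (Fin)
import Data.Fin.Properties as FinP
open import Data.Fin.Subset using (Subset; _∈_; _∉_; _⊆_; _∪_; _∩_; ⁅_⁆; ∁; ∣_∣; ⊤; ⊥)
open import Data.Fin.Subset.Properties using (_∈?_; _⊆?_; ⊆-trans)
import Data.Fin.Subset.Properties as SubsetP
open import Data.Vec using ([]; _∷_; tabulate)
import Data.Vec.Properties as VecP
open import Data.Product using (Σ; _×_; _,_; proj₂)
open import Data.Sum using (_⊎_; inj₁; inj₂)
open import Data.Empty using (⊥-elim)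
open import Function using (_∘_)
open import Relation.Binary using (Tri; tri<; tri≈; tri>)
open import Relation.Binary.PropositionalEquality
open import Relation.Nullary using (¬_; Dec; yes; no)
open import Relation.Nullary.Decidable using (does; dec-true; dec-false; _→-dec_)
open import Function.Bundles using (Equivalence)
import Algebra.Properties.CommutativeSemigroup as CommutativeSemigroupProperties
open import Defs

open CommutativeSemigroupProperties ℤP.+-commutativeSemigroup using () renaming (interchange to +-interchange)

∧-trueˡ : ∀ {a b} → a ∧ b ≡ true → a ≡ true
∧-trueˡ {true} _ = refl

∧-trueʳ : ∀ {a b} → a ∧ b ≡ true → b ≡ true
∧-trueʳ {true} e = e

∧-true⁺ : ∀ {a b} → a ≡ true → b ≡ true → a ∧ b ≡ true
∧-true⁺ refl refl = refl

∧⁴-true⁻ : ∀ {a b c d} → (a ∧ b) ∧ (c ∧ d) ≡ true → a ≡ true × b ≡ true × c ≡ true × d ≡ true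
∧⁴-true⁻ {true} {true} {true} e = refl , refl , refl , e

∧⁴-true⁺ : ∀ {a b c d} → a ≡ true → b ≡ true → c ≡ true → d ≡ true → (a ∧ b) ∧ (c ∧ d) ≡ true
∧⁴-true⁺ refl refl refl refl = refl

not-true⇒≢true : ∀ {b} → not b ≡ true → ¬ b ≡ true
not-true⇒≢true {true} ()

≢true⇒false : ∀ {b} → ¬ b ≡ true → b ≡ false
≢true⇒false {true}  h = ⊥-elim (h refl)
≢true⇒false {false} h = refl

Bool-ext : ∀ {b c} → (b ≡ true → c ≡ true) → (c ≡ true → b ≡ true) → b ≡ c
Bool-ext {true}  f g = sym (f refl)
Bool-ext {false} {true} f g = g refl
Bool-ext {false} {false} f g = refl

does-true⁻ : {P : Set} (d : Dec P) → does d ≡ true → P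
does-true⁻ (yes p) _ = p

does-cong : {P Q : Set} (d₁ : Dec P) (d₂ : Dec Q) → (P → Q) → (Q → P) → does d₁ ≡ does d₂
does-cong d₁ d₂ f g = Bool-ext (λ h → dec-true d₂ (f (does-true⁻ d₁ h)))
                               (λ h → dec-true d₁ (g (does-true⁻ d₂ h)))

T⇒true : ∀ {b} → T b → b ≡ true
T⇒true = Equivalence.to BoolP.T-≡

true⇒T : ∀ {b} → b ≡ true → T b
true⇒T = Equivalence.from BoolP.T-≡

≡ᵇ-true : ∀ {m n} → m ≡ n → (m ℕ.≡ᵇ n) ≡ true
≡ᵇ-true {m} {n} e = T⇒true (ℕP.≡⇒≡ᵇ m n e)

≡ᵇ-false : ∀ {m n} → ¬ m ≡ n → (m ℕ.≡ᵇ n) ≡ false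
≡ᵇ-false {m} {n} ne = ≢true⇒false (ne ∘ ℕP.≡ᵇ⇒≡ m n ∘ true⇒T)

≡ᵇ-true⁻ : ∀ {m n} → (m ℕ.≡ᵇ n) ≡ true → m ≡ n
≡ᵇ-true⁻ {m} {n} e = ℕP.≡ᵇ⇒≡ m n (true⇒T e)

<ᵇ-true : ∀ {m n} → m < n → (m ℕ.<ᵇ n) ≡ true
<ᵇ-true lt = T⇒true (ℕP.<⇒<ᵇ lt)

<ᵇ-false : ∀ {m n} → ¬ m < n → (m ℕ.<ᵇ n) ≡ false
<ᵇ-false {m} {n} nl = ≢true⇒false (nl ∘ ℕP.<ᵇ⇒< m n ∘ true⇒T)

≤ᵇ-true : ∀ {m n} → m ≤ n → (m ℕ.≤ᵇ n) ≡ true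
≤ᵇ-true le = T⇒true (ℕP.≤⇒≤ᵇ le)

≤ᵇ-false : ∀ {m n} → ¬ m ≤ n → (m ℕ.≤ᵇ n) ≡ false
≤ᵇ-false {m} {n} nl = ≢true⇒false (nl ∘ ℕP.≤ᵇ⇒≤ m n ∘ true⇒T)

_⊆ᵇ_ : ∀ {n} → Subset n → Subset n → Bool
A ⊆ᵇ B = does (A ⊆? B)

_==_ : ∀ {n} → Subset n → Subset n → Bool
A == B = does (VecP.≡-dec Bool._≟_ A B)

⊆ᵇ⁺ : ∀ {n} {A B : Subset n} → A ⊆ B → A ⊆ᵇ B ≡ true
⊆ᵇ⁺ {A = A} {B} = dec-true (A ⊆? B)

⊆ᵇ⁻ : ∀ {n} {A B : Subset n} → A ⊆ᵇ B ≡ true → A ⊆ B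
⊆ᵇ⁻ {A = A} {B} = does-true⁻ (A ⊆? B)

⊆ᵇ-trans : ∀ {n} (A B C : Subset n) → A ⊆ᵇ B ≡ true → B ⊆ᵇ C ≡ true → A ⊆ᵇ C ≡ true
⊆ᵇ-trans A B C A⊆B B⊆C = ⊆ᵇ⁺ (⊆-trans (⊆ᵇ⁻ {A = A} {B} A⊆B) (⊆ᵇ⁻ {A = B} {C} B⊆C))

==⁺ : ∀ {n} {A B : Subset n} → A ≡ B → A == B ≡ true
==⁺ {A = A} {B} = dec-true (VecP.≡-dec Bool._≟_ A B)

==-false : ∀ {n} {A B : Subset n} → ¬ A ≡ B → A == B ≡ false
==-false {A = A} {B} = dec-false (VecP.≡-dec Bool._≟_ A B)

==-false⁻ : ∀ {n} {A B : Subset n} → A == B ≡ false → ¬ A ≡ B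
==-false⁻ A≠B A≡B with () ← trans (sym A≠B) (==⁺ A≡B)

==-sym : ∀ {n} (A C : Subset n) → (A == C) ≡ (C == A)
==-sym A C = does-cong (VecP.≡-dec Bool._≟_ A C) (VecP.≡-dec Bool._≟_ C A) sym sym

∑ : {A : Set} → List A → (A → ℤ) → ℤ
∑ xs f = foldr _+_ 0ℤ (map f xs)

∑-cong : {A : Set} (xs : List A) {f g : A → ℤ} → (∀ x → f x ≡ g x) → ∑ xs f ≡ ∑ xs g
∑-cong []       e = refl
∑-cong (x ∷ xs) e = cong₂ _+_ (e x) (∑-cong xs e)

∑-zero : {A : Set} (xs : List A) → ∑ xs (λ _ → 0ℤ) ≡ 0ℤ
∑-zero []       = refl
∑-zero (x ∷ xs) = trans (ℤP.+-identityˡ _) (∑-zero xs)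

∑-+ : {A : Set} (xs : List A) (f g : A → ℤ) → ∑ xs (λ x → f x + g x) ≡ ∑ xs f + ∑ xs g
∑-+ []       f g = refl
∑-+ (x ∷ xs) f g = trans (cong (f x + g x +_) (∑-+ xs f g)) (+-interchange (f x) (g x) _ _)

∑-*ˡ : {A : Set} (xs : List A) (c : ℤ) (f : A → ℤ) → c * ∑ xs f ≡ ∑ xs (λ x → c * f x)
∑-*ˡ []       c f = ℤP.*-zeroʳ c
∑-*ˡ (x ∷ xs) c f = trans (ℤP.*-distribˡ-+ c (f x) _) (cong (c * f x +_) (∑-*ˡ xs c f))

∑-*ʳ : {A : Set} (xs : List A) (c : ℤ) (f : A → ℤ) → ∑ xs f * c ≡ ∑ xs (λ x → f x * c)
∑-*ʳ xs c f = trans (ℤP.*-comm _ c) (trans (∑-*ˡ xs c f) (∑-cong xs (λ x → ℤP.*-comm c (f x))))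

∑-neg : {A : Set} (xs : List A) (f : A → ℤ) → - ∑ xs f ≡ ∑ xs (λ x → - f x)
∑-neg []       f = refl
∑-neg (x ∷ xs) f = trans (ℤP.neg-distrib-+ (f x) _) (cong (- f x +_) (∑-neg xs f))

∑-swap : {A B : Set} (xs : List A) (ys : List B) (f : A → B → ℤ) →
  ∑ xs (λ x → ∑ ys (f x)) ≡ ∑ ys (λ y → ∑ xs (λ x → f x y))
∑-swap []       ys f = sym (∑-zero ys)
∑-swap (x ∷ xs) ys f = trans (cong (∑ ys (f x) +_) (∑-swap xs ys f))
                             (sym (∑-+ ys (f x) (λ y → ∑ xs (λ x → f x y))))

∑-++ : {A : Set} (xs ys : List A) (f : A → ℤ) → ∑ (xs ++ ys) f ≡ ∑ xs f + ∑ ys f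
∑-++ []       ys f = sym (ℤP.+-identityˡ _)
∑-++ (x ∷ xs) ys f = trans (cong (f x +_) (∑-++ xs ys f)) (sym (ℤP.+-assoc (f x) _ _))

∑-map : {A B : Set} (xs : List A) (g : A → B) (f : B → ℤ) → ∑ (map g xs) f ≡ ∑ xs (f ∘ g)
∑-map []       g f = refl
∑-map (x ∷ xs) g f = cong (f (g x) +_) (∑-map xs g f)

-- Sums over intervals of flats are written as sums over all subsets with
-- Iverson brackets ⟪ b ⟫ restricting the range.
⟪_⟫_ : Bool → ℤ → ℤ
⟪ b ⟫ x = if b then x else 0ℤ
infixr 8 ⟪_⟫_

∑-filter : {A : Set} (xs : List A) (p : A → Bool) (f : A → ℤ) →
  ∑ (filter (λ x → Bool.T? (p x)) xs) f ≡ ∑ xs (λ x → ⟪ p x ⟫ f x)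
∑-filter []       p f = refl
∑-filter (x ∷ xs) p f with p x
... | true  = cong (f x +_) (∑-filter xs p f)
... | false = trans (∑-filter xs p f) (sym (ℤP.+-identityˡ _))

∑-guard : {A : Set} (xs : List A) (b : Bool) (f : A → ℤ) → ⟪ b ⟫ ∑ xs f ≡ ∑ xs (λ x → ⟪ b ⟫ f x)
∑-guard xs true  f = refl
∑-guard xs false f = sym (∑-zero xs)

guard-0 : ∀ b → ⟪ b ⟫ 0ℤ ≡ 0ℤ
guard-0 true  = refl
guard-0 false = refl

guard-cong : ∀ b {x y} → (b ≡ true → x ≡ y) → ⟪ b ⟫ x ≡ ⟪ b ⟫ y
guard-cong true  h = h refl
guard-cong false h = refl

guard-*ˡ : ∀ b x y → (⟪ b ⟫ x) * y ≡ ⟪ b ⟫ (x * y)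
guard-*ˡ true  x y = refl
guard-*ˡ false x y = refl

guard-*ʳ : ∀ b x y → x * (⟪ b ⟫ y) ≡ ⟪ b ⟫ (x * y)
guard-*ʳ true  x y = refl
guard-*ʳ false x y = ℤP.*-zeroʳ x

guard²-*ʳ : ∀ a b x y → x * (⟪ a ⟫ ⟪ b ⟫ y) ≡ ⟪ a ⟫ ⟪ b ⟫ (x * y)
guard²-*ʳ a b x y = trans (guard-*ʳ a x _) (cong (⟪ a ⟫_) (guard-*ʳ b x y))

guard-neg : ∀ b x → - ⟪ b ⟫ x ≡ ⟪ b ⟫ (- x)
guard-neg true  x = refl
guard-neg false x = refl

guard-+ : ∀ b x y → ⟪ b ⟫ (x + y) ≡ ⟪ b ⟫ x + ⟪ b ⟫ y
guard-+ true  x y = refl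
guard-+ false x y = refl

guard-split : ∀ b e x → ⟪ b ⟫ x ≡ ⟪ b ∧ e ⟫ x + ⟪ b ∧ not e ⟫ x
guard-split true  true  x = sym (ℤP.+-identityʳ x)
guard-split true  false x = sym (ℤP.+-identityˡ x)
guard-split false e     x = refl

guard-∧ : ∀ a b x → ⟪ a ⟫ ⟪ b ⟫ x ≡ ⟪ a ∧ b ⟫ x
guard-∧ true  b x = refl
guard-∧ false b x = refl

guard-comm : ∀ a b x → ⟪ a ⟫ ⟪ b ⟫ x ≡ ⟪ b ⟫ ⟪ a ⟫ x
guard-comm true  b x = sym (trans (guard-∧ b true x) (cong (⟪_⟫ x) (BoolP.∧-identityʳ b)))
guard-comm false b x = sym (guard-0 b)

guard-rotate : ∀ a b c x → ⟪ a ⟫ ⟪ b ⟫ ⟪ c ⟫ x ≡ ⟪ b ⟫ ⟪ c ⟫ ⟪ a ⟫ x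
guard-rotate a b c x = trans (guard-comm a b _) (cong (⟪ b ⟫_) (guard-comm a c x))

guard⁴ : ∀ a b c d x → ⟪ a ⟫ ⟪ b ⟫ ⟪ c ⟫ ⟪ d ⟫ x ≡ ⟪ (a ∧ c) ∧ (b ∧ d) ⟫ x
guard⁴ false b     c     d x = refl
guard⁴ true  false false d x = refl
guard⁴ true  false true  d x = refl
guard⁴ true  true  c     d x = guard-∧ c d x

guard²-swap : ∀ a b c d x → ⟪ a ⟫ ⟪ b ⟫ ⟪ c ⟫ ⟪ d ⟫ x ≡ ⟪ c ⟫ ⟪ d ⟫ ⟪ a ⟫ ⟪ b ⟫ x
guard²-swap a b c d x = trans (guard⁴ a b c d x)
  (trans (cong (⟪_⟫ x) (cong₂ _∧_ (BoolP.∧-comm a c) (BoolP.∧-comm b d))) (sym (guard⁴ c d a b x)))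

*-indicator : ∀ {n} x (A B : Subset n) → x * ⟪ A == B ⟫ 1ℤ ≡ ⟪ B == A ⟫ x
*-indicator x A B = trans (guard-*ʳ (A == B) x 1ℤ) (cong₂ ⟪_⟫_ (==-sym A B) (ℤP.*-identityʳ x))

∑-upTo-point : (m k : ℕ) (g : ℕ → ℤ) → ∑ (upTo m) (λ j → ⟪ j ℕ.≡ᵇ k ⟫ g j) ≡ ⟪ k ℕ.<ᵇ m ⟫ g k
∑-upTo-point zero    k g = refl
∑-upTo-point (suc m) k g = begin
  ∑ (upTo (suc m)) h             ≡⟨ cong (λ l → ∑ l h) (sym (ListP.upTo-∷ʳ m)) ⟩
  ∑ (upTo m ++ (m ∷ [])) h       ≡⟨ ∑-++ (upTo m) (m ∷ []) h ⟩
  ∑ (upTo m) h + (h m + 0ℤ)      ≡⟨ cong₂ _+_ (∑-upTo-point m k g) (ℤP.+-identityʳ (h m)) ⟩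
  ⟪ k ℕ.<ᵇ m ⟫ g k + h m         ≡⟨ last (ℕP.<-cmp k m) ⟩
  ⟪ k ℕ.<ᵇ suc m ⟫ g k           ∎
  where
  open ≡-Reasoning
  h = λ j → ⟪ j ℕ.≡ᵇ k ⟫ g j
  last : Tri (k < m) (k ≡ m) (m < k) → ⟪ k ℕ.<ᵇ m ⟫ g k + h m ≡ ⟪ k ℕ.<ᵇ suc m ⟫ g k
  last (tri< k<m _ _) rewrite <ᵇ-true k<m | <ᵇ-true (ℕP.m<n⇒m<1+n k<m)
    | ≡ᵇ-false {m} {k} (λ e → ℕP.<⇒≢ k<m (sym e)) = ℤP.+-identityʳ _
  last (tri≈ _ refl _) rewrite ≡ᵇ-true {k} {k} refl | <ᵇ-true (ℕP.n<1+n k)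
    | <ᵇ-false (ℕP.<-irrefl {k} refl) = ℤP.+-identityˡ _
  last (tri> _ _ m<k) rewrite <ᵇ-false (ℕP.<⇒≯ m<k) | ≡ᵇ-false {m} {k} (ℕP.<⇒≢ m<k)
    | <ᵇ-false {k} {suc m} (λ k<sm → ℕP.<⇒≱ m<k (ℕP.≤-pred k<sm)) = refl

opaque
  ∑ₛ : ∀ {n} → (Subset n → ℤ) → ℤ
  ∑ₛ {n} f = ∑ (allSubsets n) f

  ∑ₛ-cong : ∀ {n} {f g : Subset n → ℤ} → (∀ X → f X ≡ g X) → ∑ₛ f ≡ ∑ₛ g
  ∑ₛ-cong {n} = ∑-cong (allSubsets n)

  ∑ₛ-split : ∀ n (f : Subset (suc n) → ℤ) →
    ∑ₛ f ≡ ∑ₛ (λ X → f (true ∷ X)) + ∑ₛ (λ X → f (false ∷ X))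
  ∑ₛ-split n f = trans (∑-++ (map (true ∷_) (allSubsets n)) _ f)
                       (cong₂ _+_ (∑-map (allSubsets n) _ f) (∑-map (allSubsets n) _ f))

  ∑ₛ-zero : ∀ n → ∑ₛ {n} (λ _ → 0ℤ) ≡ 0ℤ
  ∑ₛ-zero n = ∑-zero (allSubsets n)

  ∑ₛ-point : ∀ {n} (F : Subset n) (f : Subset n → ℤ) → ∑ₛ (λ X → ⟪ X == F ⟫ f X) ≡ f F
  ∑ₛ-point {zero}  []          f = ℤP.+-identityʳ _
  ∑ₛ-point {suc n} (true ∷ F)  f =
    trans (∑ₛ-split n (λ X → ⟪ X == (true ∷ F) ⟫ f X))
          (trans (cong₂ _+_ (∑ₛ-point F (λ X → f (true ∷ X))) (∑ₛ-zero n)) (ℤP.+-identityʳ _))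
  ∑ₛ-point {suc n} (false ∷ F) f =
    trans (∑ₛ-split n (λ X → ⟪ X == (false ∷ F) ⟫ f X))
          (trans (cong₂ _+_ (∑ₛ-zero n) (∑ₛ-point F (λ X → f (false ∷ X)))) (ℤP.+-identityˡ _))

  ∑ₛ-⊇∁ : ∀ {n} (G : Subset n) (f : Subset n → ℤ) →
    ∑ₛ (λ X → ⟪ ∁ G ⊆ᵇ X ⟫ f X) ≡ ∑ₛ (λ Y → ⟪ Y ⊆ᵇ G ⟫ f (Y ∪ ∁ G))
  ∑ₛ-⊇∁ {zero}  []          f = refl
  ∑ₛ-⊇∁ {suc n} (true ∷ G)  f = begin
    ∑ₛ (λ X → ⟪ ∁ (true ∷ G) ⊆ᵇ X ⟫ f X)
      ≡⟨ ∑ₛ-split n _ ⟩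
    _ ≡⟨ cong₂ _+_ (∑ₛ-⊇∁ G (λ X → f (true ∷ X))) (∑ₛ-⊇∁ G (λ X → f (false ∷ X))) ⟩
    _ ≡⟨ sym (∑ₛ-split n (λ Y → ⟪ Y ⊆ᵇ (true ∷ G) ⟫ f (Y ∪ ∁ (true ∷ G)))) ⟩
    ∑ₛ (λ Y → ⟪ Y ⊆ᵇ (true ∷ G) ⟫ f (Y ∪ ∁ (true ∷ G))) ∎
    where open ≡-Reasoning
  ∑ₛ-⊇∁ {suc n} (false ∷ G) f = begin
    ∑ₛ (λ X → ⟪ ∁ (false ∷ G) ⊆ᵇ X ⟫ f X)
      ≡⟨ ∑ₛ-split n _ ⟩
    ∑ₛ (λ X → ⟪ ∁ G ⊆ᵇ X ⟫ f (true ∷ X)) + ∑ₛ {n} (λ X → 0ℤ)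
      ≡⟨ cong₂ _+_ (∑ₛ-⊇∁ G (λ X → f (true ∷ X))) (∑ₛ-zero n) ⟩
    ∑ₛ (λ Y → ⟪ Y ⊆ᵇ G ⟫ f (true ∷ (Y ∪ ∁ G))) + 0ℤ
      ≡⟨ ℤP.+-comm (∑ₛ (λ Y → ⟪ Y ⊆ᵇ G ⟫ f (true ∷ (Y ∪ ∁ G)))) 0ℤ ⟩
    0ℤ + ∑ₛ (λ Y → ⟪ Y ⊆ᵇ G ⟫ f (true ∷ (Y ∪ ∁ G)))
      ≡⟨ cong₂ _+_ (sym (∑ₛ-zero n)) refl ⟩
    ∑ₛ {n} (λ Y → 0ℤ) + ∑ₛ (λ Y → ⟪ Y ⊆ᵇ G ⟫ f (true ∷ (Y ∪ ∁ G)))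
      ≡⟨ sym (∑ₛ-split n (λ Y → ⟪ Y ⊆ᵇ (false ∷ G) ⟫ f (Y ∪ ∁ (false ∷ G)))) ⟩
    ∑ₛ (λ Y → ⟪ Y ⊆ᵇ (false ∷ G) ⟫ f (Y ∪ ∁ (false ∷ G))) ∎
    where open ≡-Reasoning

  ∑ₛ-guard : ∀ {n} b (f : Subset n → ℤ) → ⟪ b ⟫ ∑ₛ f ≡ ∑ₛ (λ X → ⟪ b ⟫ f X)
  ∑ₛ-guard {n} = ∑-guard (allSubsets n)

  ∑ₛ-guard² : ∀ {n} a b (f : Subset n → ℤ) → ⟪ a ⟫ ⟪ b ⟫ ∑ₛ f ≡ ∑ₛ (λ X → ⟪ a ⟫ ⟪ b ⟫ f X)
  ∑ₛ-guard² a b f = trans (cong (⟪ a ⟫_) (∑ₛ-guard b f)) (∑ₛ-guard a (λ X → ⟪ b ⟫ f X))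

  ∑ₛ-*ˡ : ∀ {n} c (f : Subset n → ℤ) → c * ∑ₛ f ≡ ∑ₛ (λ X → c * f X)
  ∑ₛ-*ˡ {n} = ∑-*ˡ (allSubsets n)

  ∑ₛ-+ : ∀ {n} (f g : Subset n → ℤ) → ∑ₛ (λ X → f X + g X) ≡ ∑ₛ f + ∑ₛ g
  ∑ₛ-+ {n} = ∑-+ (allSubsets n)

  ∑ₛ-neg : ∀ {n} (f : Subset n → ℤ) → - ∑ₛ f ≡ ∑ₛ (λ X → - f X)
  ∑ₛ-neg {n} = ∑-neg (allSubsets n)

  ∑ₛ-swap : ∀ {n m} (f : Subset n → Subset m → ℤ) →
    ∑ₛ (λ X → ∑ₛ (λ Y → f X Y)) ≡ ∑ₛ (λ Y → ∑ₛ (λ X → f X Y))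
  ∑ₛ-swap {n} {m} = ∑-swap (allSubsets n) (allSubsets m)

  ∑ₛ-zero′ : ∀ {n} (f : Subset n → ℤ) → (∀ X → f X ≡ 0ℤ) → ∑ₛ f ≡ 0ℤ
  ∑ₛ-zero′ {n} f h = trans (∑ₛ-cong h) (∑ₛ-zero n)

  ∑ₛ-filter : ∀ {n} (p : Subset n → Bool) (f : Subset n → ℤ) →
    ∑ (filter (λ X → Bool.T? (p X)) (allSubsets n)) f ≡ ∑ₛ (λ X → ⟪ p X ⟫ f X)
  ∑ₛ-filter {n} = ∑-filter (allSubsets n)

_≈_ : Poly → Poly → Set
p ≈ q = ∀ i → p i ≡ q i
infix 4 _≈_

shift : ℕ → Poly → Poly
shift k q i = ⟪ k ℕ.≤ᵇ i ⟫ q (i ∸ k)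

-- t^m q(t⁻¹); the coefficients of q above degree m are discarded.
reflect : ℕ → Poly → Poly
reflect m q i = ⟪ i ℕ.≤ᵇ m ⟫ q (m ∸ i)

sumP-coeff : {A : Set} (xs : List A) (f : A → Poly) (i : ℕ) → sumP xs f i ≡ ∑ xs (λ x → f x i)
sumP-coeff []       f i = refl
sumP-coeff (x ∷ xs) f i = cong (f x i +_) (sumP-coeff xs f i)

<ᵇ-suc : ∀ k i → (k ℕ.<ᵇ suc i) ≡ (k ℕ.≤ᵇ i)
<ᵇ-suc zero    i = refl
<ᵇ-suc (suc k) i = refl

monoP-*P : (c : ℤ) (k : ℕ) (q : Poly) (i : ℕ) → (monoP c k *P q) i ≡ c * shift k q i
monoP-*P c k q i = begin
  ∑ (upTo (suc i)) (λ j → monoP c k j * q (i ∸ j))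
    ≡⟨ ∑-cong (upTo (suc i)) (λ j → guard-*ˡ (j ℕ.≡ᵇ k) c (q (i ∸ j))) ⟩
  ∑ (upTo (suc i)) (λ j → ⟪ j ℕ.≡ᵇ k ⟫ (c * q (i ∸ j)))
    ≡⟨ ∑-upTo-point (suc i) k (λ j → c * q (i ∸ j)) ⟩
  ⟪ k ℕ.<ᵇ suc i ⟫ (c * q (i ∸ k))
    ≡⟨ cong (⟪_⟫ (c * q (i ∸ k))) (<ᵇ-suc k i) ⟩
  ⟪ k ℕ.≤ᵇ i ⟫ (c * q (i ∸ k))
    ≡⟨ sym (guard-*ʳ (k ℕ.≤ᵇ i) c _) ⟩
  c * shift k q i ∎
  where open ≡-Reasoning

*P-cong : {p p′ q q′ : Poly} → p ≈ p′ → q ≈ q′ → p *P q ≈ p′ *P q′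
*P-cong ep eq i = ∑-cong (upTo (suc i)) (λ j → cong₂ _*_ (ep j) (eq (i ∸ j)))

*P-congʳ : (p : Poly) {q q′ : Poly} → q ≈ q′ → p *P q ≈ p *P q′
*P-congʳ p = *P-cong {p} (λ _ → refl)

sumP-*P : {A : Set} (xs : List A) (f : A → Poly) (q : Poly) (i : ℕ) →
  (sumP xs f *P q) i ≡ ∑ xs (λ x → (f x *P q) i)
sumP-*P xs f q i = begin
  ∑ (upTo (suc i)) (λ j → sumP xs f j * q (i ∸ j))
    ≡⟨ ∑-cong (upTo (suc i)) (λ j → trans (cong (_* q (i ∸ j)) (sumP-coeff xs f j))
                                           (∑-*ʳ xs (q (i ∸ j)) _)) ⟩
  ∑ (upTo (suc i)) (λ j → ∑ xs (λ x → f x j * q (i ∸ j)))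
    ≡⟨ ∑-swap (upTo (suc i)) xs _ ⟩
  ∑ xs (λ x → (f x *P q) i) ∎
  where open ≡-Reasoning

shift-cong : ∀ k {q q′} → q ≈ q′ → shift k q ≈ shift k q′
shift-cong k e i = cong (⟪ k ℕ.≤ᵇ i ⟫_) (e (i ∸ k))

shift-shift : ∀ a b q → shift a (shift b q) ≈ shift (a ℕ.+ b) q
shift-shift a b q i with a ≤? i
... | no a≰i rewrite ≤ᵇ-false a≰i
  = sym (cong (⟪_⟫ q (i ∸ (a ℕ.+ b))) (≤ᵇ-false (λ h → a≰i (ℕP.≤-trans (ℕP.m≤m+n a b) h))))
... | yes a≤i rewrite ≤ᵇ-true a≤i with b ≤? i ∸ a | a ℕ.+ b ≤? i
...   | yes h | yes h′ rewrite ≤ᵇ-true h | ≤ᵇ-true h′ = cong q (ℕP.∸-+-assoc i a b)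
...   | yes h | no h′ = ⊥-elim (h′ (subst (a ℕ.+ b ≤_) (ℕP.m+[n∸m]≡n a≤i) (ℕP.+-monoʳ-≤ a h)))
...   | no h  | yes h′ = ⊥-elim (h (ℕP.m+n≤o⇒m≤o∸n b (subst (_≤ i) (ℕP.+-comm a b) h′)))
...   | no h  | no h′ rewrite ≤ᵇ-false h | ≤ᵇ-false h′ = refl

private
  shuffle : ∀ j b t → b ℕ.+ (j ℕ.+ t) ≡ j ℕ.+ (t ℕ.+ b)
  shuffle = solve-∀

reflect-shift : ∀ a b c q → (∀ j → c < j → q j ≡ 0ℤ) →
  reflect (a ℕ.+ b ℕ.+ c) (shift b q) ≈ shift a (reflect c q)
reflect-shift a b c q deg i with a ≤? i
... | no a≰i with (u , refl) ← ℕP.m≤n⇒∃[o]m+o≡n (ℕP.≰⇒> a≰i) rewrite ≤ᵇ-false a≰i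
  = trans (cong (λ z → ⟪ i ℕ.≤ᵇ N ⟫ ⟪ b ℕ.≤ᵇ N ∸ i ⟫ z) (deg _ c<index))
          (trans (cong (⟪ i ℕ.≤ᵇ N ⟫_) (guard-0 (b ℕ.≤ᵇ N ∸ i))) (guard-0 (i ℕ.≤ᵇ N)))
  where
  N = suc (i ℕ.+ u) ℕ.+ b ℕ.+ c
  reassoc : ∀ i u b c → suc (i ℕ.+ u) ℕ.+ b ℕ.+ c ≡ i ℕ.+ (suc u ℕ.+ c ℕ.+ b)
  reassoc = solve-∀
  c<index : c < suc (i ℕ.+ u) ℕ.+ b ℕ.+ c ∸ i ∸ b
  c<index rewrite reassoc i u b c | ℕP.m+n∸m≡n i (suc u ℕ.+ c ℕ.+ b) | ℕP.m+n∸n≡m (suc u ℕ.+ c) b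
    = s≤s (ℕP.m≤n+m c u)
... | yes a≤i with (j , refl) ← ℕP.m≤n⇒∃[o]m+o≡n a≤i
  rewrite ≤ᵇ-true a≤i | ℕP.m+n∸m≡n a j | ℕP.+-assoc a b c | ℕP.[m+n]∸[m+o]≡n∸o a (b ℕ.+ c) j
  with j ≤? c
...   | yes j≤c with (t , refl) ← ℕP.m≤n⇒∃[o]m+o≡n j≤c
  rewrite ≤ᵇ-true j≤c | ≤ᵇ-true (ℕP.+-monoʳ-≤ a (ℕP.≤-trans j≤c (ℕP.m≤n+m (j ℕ.+ t) b)))
        | shuffle j b t | ℕP.m+n∸m≡n j (t ℕ.+ b) | ℕP.m+n∸m≡n j t
        | ≤ᵇ-true (ℕP.m≤n+m b t) | ℕP.m+n∸n≡m t b = refl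
...   | no j≰c rewrite ≤ᵇ-false j≰c with a ℕ.+ j ≤? a ℕ.+ (b ℕ.+ c)
...     | no h rewrite ≤ᵇ-false h = refl
...     | yes h rewrite ≤ᵇ-true h with b ≤? b ℕ.+ c ∸ j
...       | no h′ rewrite ≤ᵇ-false h′ = refl
...       | yes h′ =
  ⊥-elim (j≰c (ℕP.+-cancelˡ-≤ b j c (subst (b ℕ.+ j ≤_) (ℕP.m∸n+n≡m j≤b+c) (ℕP.+-monoˡ-≤ j h′))))
  where
  j≤b+c : j ≤ b ℕ.+ c
  j≤b+c = ℕP.+-cancelˡ-≤ a j (b ℕ.+ c) h

x≡-x⇒x≡0 : ∀ x → x ≡ - x → x ≡ 0ℤ
x≡-x⇒x≡0 (ℤ.+ zero)    _ = refl
x≡-x⇒x≡0 (ℤ.+ (suc n)) ()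
x≡-x⇒x≡0 ℤ.-[1+ n ]    ()

0≡-x⇒x≡0 : ∀ x → 0ℤ ≡ - x → x ≡ 0ℤ
0≡-x⇒x≡0 x e = trans (sym (ℤP.neg-involutive x)) (cong -_ (sym e))

x+y+z≡x⇒z≡-y : ∀ x y z → x + y + z ≡ x → z ≡ - y
x+y+z≡x⇒z≡-y x y z e = begin
  z                          ≡⟨ regroup x y z ⟩
  (x + y + z) + - x + - y    ≡⟨ cong (λ w → w + - x + - y) e ⟩
  x + - x + - y              ≡⟨ cong (_+ - y) (ℤP.+-inverseʳ x) ⟩
  0ℤ + - y                   ≡⟨ ℤP.+-identityˡ (- y) ⟩
  - y                        ∎
  where
  open ≡-Reasoning
  regroup : ∀ x y z → z ≡ (x + y + z) + - x + - y
  regroup = ℤ-Solver.solve-∀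

-- If t^D Q(t⁻¹) = -Q(t) and P is the part of -Q below degree D/2, then
-- t^D P(t⁻¹) = P(t) + Q(t): antisymmetry kills the middle coefficient and
-- swaps the two halves of Q.
reflect-lowerHalf : ∀ D (p q : Poly) → ¬ D ≡ 0 →
  (∀ j → p j ≡ ⟪ (2 ℕ.* j) ℕ.<ᵇ D ⟫ (- q j)) → (∀ j → reflect D q j ≡ - q j) →
  ∀ i → reflect D p i ≡ p i + q i
reflect-lowerHalf D p q D≢0 p-def q-anti i with i ≤? D
... | no i≰D rewrite ≤ᵇ-false i≰D | p-def i
    | <ᵇ-false {2 ℕ.* i} {D} (λ h → i≰D (ℕP.<⇒≤ (ℕP.≤-<-trans (ℕP.m≤m+n i (i ℕ.+ 0)) h)))
  = sym (trans (ℤP.+-identityˡ _)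
               (0≡-x⇒x≡0 (q i) (trans (sym (cong (⟪_⟫ q (D ∸ i)) (≤ᵇ-false i≰D))) (q-anti i))))
... | yes i≤D with (j , refl) ← ℕP.m≤n⇒∃[o]m+o≡n i≤D
  rewrite ≤ᵇ-true i≤D | ℕP.m+n∸m≡n i j | p-def i | p-def j = compare (ℕP.<-cmp i j)
  where
  qj≡-qi : q j ≡ - q i
  qj≡-qi = trans (sym (trans (cong (⟪_⟫ q (i ℕ.+ j ∸ i)) (≤ᵇ-true i≤D)) (cong q (ℕP.m+n∸m≡n i j))))
                 (q-anti i)
  double : ∀ x → 2 ℕ.* x ≡ x ℕ.+ x
  double x = cong (x ℕ.+_) (ℕP.+-identityʳ x)
  compare : Tri (i < j) (i ≡ j) (j < i) →
    ⟪ (2 ℕ.* j) ℕ.<ᵇ i ℕ.+ j ⟫ (- q j) ≡ ⟪ (2 ℕ.* i) ℕ.<ᵇ i ℕ.+ j ⟫ (- q i) + q i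
  compare (tri< i<j _ _)
    rewrite <ᵇ-false {2 ℕ.* j} {i ℕ.+ j}
              (λ h → ℕP.<-asym i<j (ℕP.+-cancelʳ-< j j i (subst (_< i ℕ.+ j) (double j) h)))
          | <ᵇ-true {2 ℕ.* i} {i ℕ.+ j} (subst (_< i ℕ.+ j) (sym (double i)) (ℕP.+-monoʳ-< i i<j))
    = sym (ℤP.+-inverseˡ (q i))
  compare (tri≈ _ refl _) rewrite <ᵇ-false {2 ℕ.* i} {i ℕ.+ i} (λ h → ℕP.<-irrefl (double i) h)
    = sym (trans (ℤP.+-identityˡ _) (x≡-x⇒x≡0 (q i) qj≡-qi))
  compare (tri> _ _ j<i)
    rewrite <ᵇ-true {2 ℕ.* j} {i ℕ.+ j} (subst (_< i ℕ.+ j) (sym (double j)) (ℕP.+-monoˡ-< j j<i))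
          | <ᵇ-false {2 ℕ.* i} {i ℕ.+ j}
              (λ h → ℕP.<-asym j<i (ℕP.+-cancelˡ-< i i j (subst (_< i ℕ.+ j) (double i) h)))
    = trans (cong -_ qj≡-qi) (trans (ℤP.neg-involutive (q i)) (sym (ℤP.+-identityˡ _)))

[a∸c]∸[b∸c]≡a∸b : ∀ a {b c} → c ≤ b → (a ∸ c) ∸ (b ∸ c) ≡ a ∸ b
[a∸c]∸[b∸c]≡a∸b a {b} {c} c≤b = trans (ℕP.∸-+-assoc a c (b ∸ c)) (cong (a ∸_) (ℕP.m+[n∸m]≡n c≤b))

[b∸a]+[c∸b]≡c∸a : ∀ {a b c} → a ≤ b → b ≤ c → (b ∸ a) ℕ.+ (c ∸ b) ≡ c ∸ a
[b∸a]+[c∸b]≡c∸a {a} {b} {c} a≤b b≤c =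
  trans (sym (ℕP.+-∸-comm (c ∸ b) a≤b)) (cong (_∸ a) (trans (ℕP.+-comm b _) (ℕP.m∸n+n≡m b≤c)))

[b∸a]+[c∸b]+[d∸c]≡d∸a : ∀ {a b c d} → a ≤ b → b ≤ c → c ≤ d → (b ∸ a) ℕ.+ (c ∸ b) ℕ.+ (d ∸ c) ≡ d ∸ a
[b∸a]+[c∸b]+[d∸c]≡d∸a {c = c} {d = d} a≤b b≤c c≤d =
  trans (cong (ℕ._+ (d ∸ c)) ([b∸a]+[c∸b]≡c∸a a≤b b≤c)) ([b∸a]+[c∸b]≡c∸a (ℕP.≤-trans a≤b b≤c) c≤d)

reflect-0-antisym : ∀ q → (∀ j → reflect 0 q j ≡ - q j) → ∀ j → q j ≡ 0ℤ
reflect-0-antisym q anti zero    = x≡-x⇒x≡0 (q 0) (anti 0)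
reflect-0-antisym q anti (suc j) = 0≡-x⇒x≡0 (q (suc j)) (anti (suc j))

reflect-0-oneP : reflect 0 oneP ≈ oneP
reflect-0-oneP zero    = refl
reflect-0-oneP (suc j) = refl

⊆-witness : ∀ {n} {B H : Subset n} → ¬ (B ⊆ H) → Σ (Fin n) (λ x → x ∈ B × x ∉ H)
⊆-witness {n} {B} {H} B⊈H
  with FinP.¬∀⟶∃¬ n (λ x → x ∈ B → x ∈ H) (λ x → (x ∈? B) →-dec (x ∈? H)) (λ f → B⊈H (λ {x} → f x))
... | x , x∈B⇏x∈H with x ∈? B
...   | yes x∈B = x , x∈B , (λ x∈H → x∈B⇏x∈H (λ _ → x∈H))
...   | no x∉B  = ⊥-elim (x∈B⇏x∈H (λ x∈B → ⊥-elim (x∉B x∈B)))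

⊂-card : ∀ {n} {H B : Subset n} → H ⊆ B → ¬ H ≡ B → ∣ H ∣ < ∣ B ∣
⊂-card {H = H} {B} H⊆B H≢B with ⊆-witness {B = B} {H} (H≢B ∘ SubsetP.⊆-antisym H⊆B)
... | x , x∈B , x∉H = SubsetP.p⊂q⇒∣p∣<∣q∣ (H⊆B , x , x∈B , x∉H)

∈-tabulate⁺ : ∀ {n} (f : Fin n → Bool) e → f e ≡ true → e ∈ tabulate f
∈-tabulate⁺ f e h = VecP.lookup⇒[]= e (tabulate f) (trans (VecP.lookup∘tabulate f e) h)

∈-tabulate⁻ : ∀ {n} (f : Fin n → Bool) e → e ∈ tabulate f → f e ≡ true
∈-tabulate⁻ f e h = trans (sym (VecP.lookup∘tabulate f e)) (VecP.[]=⇒lookup h)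

⁅⁆-⊆ : ∀ {n} {e : Fin n} {A} → e ∈ A → ⁅ e ⁆ ⊆ A
⁅⁆-⊆ {e = e} {A} e∈A y∈⁅e⁆ = subst (_∈ A) (sym (SubsetP.x∈⁅y⁆⇒x≡y e y∈⁅e⁆)) e∈A

∪-lub : ∀ {n} {A B C : Subset n} → A ⊆ C → B ⊆ C → A ∪ B ⊆ C
∪-lub {A = A} {B} ac bc x with SubsetP.x∈p∪q⁻ A B x
... | inj₁ h = ac h
... | inj₂ h = bc h

⊆-∪ˡ : ∀ {n} (A B : Subset n) → A ⊆ A ∪ B
⊆-∪ˡ A B = SubsetP.p⊆p∪q B

⊆-∪ʳ : ∀ {n} (A B : Subset n) → B ⊆ A ∪ B
⊆-∪ʳ A B = SubsetP.q⊆p∪q A B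

∩-glb : ∀ {n} {A B C : Subset n} → C ⊆ A → C ⊆ B → C ⊆ A ∩ B
∩-glb ca cb x = SubsetP.x∈p∩q⁺ (ca x , cb x)

∩-⊆ˡ : ∀ {n} (A B : Subset n) → A ∩ B ⊆ A
∩-⊆ˡ = SubsetP.p∩q⊆p

∩-⊆ʳ : ∀ {n} (A B : Subset n) → A ∩ B ⊆ B
∩-⊆ʳ = SubsetP.p∩q⊆q

foldr-∧-true⁺ : {A : Set} (f : A → Bool) (xs : List A) →
  (∀ x → x ListM.∈ xs → f x ≡ true) → foldr (λ e b → f e ∧ b) true xs ≡ true
foldr-∧-true⁺ f [] h = refl
foldr-∧-true⁺ f (x ∷ xs) h rewrite h x (here refl) = foldr-∧-true⁺ f xs (λ y m → h y (there m))

foldr-∧-true⁻ : {A : Set} (f : A → Bool) (xs : List A) →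
  foldr (λ e b → f e ∧ b) true xs ≡ true → ∀ x → x ListM.∈ xs → f x ≡ true
foldr-∧-true⁻ f (y ∷ xs) h x m with f y in eq
foldr-∧-true⁻ f (y ∷ xs) h x (here refl) | true = eq
foldr-∧-true⁻ f (y ∷ xs) h x (there m) | true = foldr-∧-true⁻ f xs h x m

∑-flats-filter : ∀ {n} (ρ : RankFn n) (p : Subset n → Bool) (f : Subset n → ℤ) →
  ∑ (filter (λ H → Bool.T? (p H)) (flats ρ)) f ≡ ∑ₛ (λ H → ⟪ isFlat ρ H ⟫ ⟪ p H ⟫ f H)
∑-flats-filter {n} ρ p f = trans (∑-filter (flats ρ) p f) (∑ₛ-filter (isFlat ρ) _)

filter-cong : {A : Set} (p q : A → Bool) (xs : List A) → (∀ x → p x ≡ q x) →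
  filter (λ x → Bool.T? (p x)) xs ≡ filter (λ x → Bool.T? (q x)) xs
filter-cong p q [] e = refl
filter-cong p q (x ∷ xs) e with p x | q x | e x
... | true  | .true  | refl = cong (x ∷_) (filter-cong p q xs e)
... | false | .false | refl = filter-cong p q xs e

module _ {n : ℕ} (ρ₁ ρ₂ : RankFn n) (e : ∀ X → ρ₁ X ≡ ρ₂ X) where

  isFlat-ext : ∀ X → isFlat ρ₁ X ≡ isFlat ρ₂ X
  isFlat-ext X = ListP.foldr-cong (λ x b → cong (λ z → (does (x ∈? X) ∨ not z) ∧ b)
                                                  (cong₂ ℕ._≡ᵇ_ (e (X ∪ ⁅ x ⁆)) (e X)))
                                  refl (allFin n)

  flats-ext : flats ρ₁ ≡ flats ρ₂
  flats-ext = filter-cong (isFlat ρ₁) (isFlat ρ₂) (allSubsets n) isFlat-ext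

  bot-ext : bot ρ₁ ≡ bot ρ₂
  bot-ext = VecP.tabulate-cong (λ x → cong₂ ℕ._≡ᵇ_ (e _) (e _))

  mobiusF-ext : ∀ k A B → mobiusF ρ₁ k A B ≡ mobiusF ρ₂ k A B
  mobiusF-ext zero A C = refl
  mobiusF-ext (suc k) A C with does (A ⊆? C)
  ... | false = refl
  ... | true with does (VecP.≡-dec Bool._≟_ A C)
  ...   | true = refl
  ...   | false rewrite flats-ext = cong -_ (∑-cong (filter _ (flats ρ₂)) (mobiusF-ext k A))

  charPoly-ext : charPoly ρ₁ ≈ charPoly ρ₂
  charPoly-ext i rewrite flats-ext | bot-ext =
    trans (sumP-coeff (flats ρ₂) _ i)
          (trans (∑-cong (flats ρ₂) (λ X → cong₂ (λ a b → monoP a b i)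
                                                 (mobiusF-ext (suc n) (bot ρ₂) X) (cong₂ _∸_ (e ⊤) (e X))))
                 (sym (sumP-coeff (flats ρ₂) _ i)))

-- Needed because con (con ρ F) G and con ρ G agree only pointwise.
klF-ext : ∀ k {n} (ρ₁ ρ₂ : RankFn n) → (∀ X → ρ₁ X ≡ ρ₂ X) → klF k ρ₁ ≈ klF k ρ₂
klF-ext zero    ρ₁ ρ₂ e i = refl
klF-ext (suc k) ρ₁ ρ₂ e i with rank ρ₁ ℕ.≡ᵇ 0 | rank ρ₂ ℕ.≡ᵇ 0 | cong (ℕ._≡ᵇ 0) (e ⊤)
... | true  | .true  | refl = refl
... | false | .false | refl rewrite e ⊤ | flats-ext ρ₁ ρ₂ e | bot-ext ρ₁ ρ₂ e =
  cong (λ z → if (2 ℕ.* i) ℕ.<ᵇ ρ₂ ⊤ then - z else 0ℤ)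
    (trans (sumP-coeff L _ i)
       (trans (∑-cong L (λ F → *P-cong (charPoly-ext (loc ρ₁ F) (loc ρ₂ F) (λ X → e (X ∩ F)))
                                       (klF-ext k (con ρ₁ F) (con ρ₂ F) (λ X → cong₂ _∸_ (e (X ∪ F)) (e F))) i))
              (sym (sumP-coeff L _ i))))
  where
  L = filter (λ F → Bool.T? (not (F == bot ρ₂))) (flats ρ₂)

-- Flats and sums over intervals of flats

module Flats {n : ℕ} (ρ : RankFn n) where

  flat : Subset n → Set
  flat X = isFlat ρ X ≡ true

  flat⇒rank-jumps : ∀ {X} → flat X → ∀ e → e ∉ X → ¬ ρ (X ∪ ⁅ e ⁆) ≡ ρ X
  flat⇒rank-jumps {X} fX e ne eq with foldr-∧-true⁻ _ (allFin n) fX e (ListMP.∈-allFin e)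
  ... | h with e ∈? X
  ...   | yes ex = ne ex
  ...   | no _ rewrite ≡ᵇ-true eq with () ← h

  rank-jumps⇒flat : ∀ {X} → (∀ e → e ∉ X → ¬ ρ (X ∪ ⁅ e ⁆) ≡ ρ X) → flat X
  rank-jumps⇒flat {X} h = foldr-∧-true⁺ _ (allFin n) λ e _ → jump e
    where
    jump : ∀ e → (does (e ∈? X) ∨ not (ρ (X ∪ ⁅ e ⁆) ℕ.≡ᵇ ρ X)) ≡ true
    jump e with e ∈? X
    ... | yes _ = refl
    ... | no ne rewrite ≡ᵇ-false (h e ne) = refl

  _∈ᵇ[_,_] : Subset n → Subset n → Subset n → Bool
  K ∈ᵇ[ A , C ] = A ⊆ᵇ K ∧ K ⊆ᵇ C

  ∑[_,_] : Subset n → Subset n → (Subset n → ℤ) → ℤ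
  ∑[ A , C ] f = ∑ₛ (λ K → ⟪ isFlat ρ K ⟫ ⟪ K ∈ᵇ[ A , C ] ⟫ f K)

  ∑[]-cong : ∀ A C {f g : Subset n → ℤ} → (∀ K → flat K → A ⊆ K → K ⊆ C → f K ≡ g K) →
    ∑[ A , C ] f ≡ ∑[ A , C ] g
  ∑[]-cong A C e = ∑ₛ-cong λ K → guard-cong (isFlat ρ K) λ fK →
    guard-cong (K ∈ᵇ[ A , C ]) λ h → e K fK (⊆ᵇ⁻ (∧-trueˡ h)) (⊆ᵇ⁻ (∧-trueʳ {A ⊆ᵇ K} h))

  ∑[]-zero : ∀ A C {f : Subset n → ℤ} → (∀ K → flat K → A ⊆ K → K ⊆ C → f K ≡ 0ℤ) → ∑[ A , C ] f ≡ 0ℤ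
  ∑[]-zero A C h = trans (∑[]-cong A C h)
    (∑ₛ-zero′ _ λ K → trans (cong (⟪ isFlat ρ K ⟫_) (guard-0 (K ∈ᵇ[ A , C ]))) (guard-0 (isFlat ρ K)))

  ∑[]-empty : ∀ {A C} (f : Subset n → ℤ) → ¬ A ⊆ C → ∑[ A , C ] f ≡ 0ℤ
  ∑[]-empty {A} {C} f A⊈C = ∑[]-zero A C (λ K _ A⊆K K⊆C → ⊥-elim (A⊈C (⊆-trans A⊆K K⊆C)))

  ∑[]-+ : ∀ A C (f g : Subset n → ℤ) → ∑[ A , C ] (λ K → f K + g K) ≡ ∑[ A , C ] f + ∑[ A , C ] g
  ∑[]-+ A C f g = trans (∑ₛ-cong λ K → trans (cong (⟪ isFlat ρ K ⟫_) (guard-+ (K ∈ᵇ[ A , C ]) _ _))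
                                             (guard-+ (isFlat ρ K) _ _))
                        (∑ₛ-+ _ _)

  ∑[]-*ˡ : ∀ A C c (f : Subset n → ℤ) → c * ∑[ A , C ] f ≡ ∑[ A , C ] (λ K → c * f K)
  ∑[]-*ˡ A C c f = trans (∑ₛ-*ˡ c _) (∑ₛ-cong λ K → guard²-*ʳ (isFlat ρ K) _ c (f K))

  ∑[]-neg : ∀ A C (f : Subset n → ℤ) → - ∑[ A , C ] f ≡ ∑[ A , C ] (λ K → - f K)
  ∑[]-neg A C f = trans (∑ₛ-neg _) (∑ₛ-cong λ K →
    trans (guard-neg (isFlat ρ K) _) (cong (⟪ isFlat ρ K ⟫_) (guard-neg (K ∈ᵇ[ A , C ]) (f K))))

  ∑[]-guard : ∀ A C b (f : Subset n → ℤ) → ⟪ b ⟫ ∑[ A , C ] f ≡ ∑[ A , C ] (λ K → ⟪ b ⟫ f K)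
  ∑[]-guard A C b f = trans (∑ₛ-guard b _) (∑ₛ-cong λ K → guard-rotate b (isFlat ρ K) _ (f K))

  ∑[]-swap : ∀ A C B D (f : Subset n → Subset n → ℤ) →
    ∑[ A , C ] (λ K → ∑[ B , D ] (f K)) ≡ ∑[ B , D ] (λ L → ∑[ A , C ] (λ K → f K L))
  ∑[]-swap A C B D f = begin
    ∑ₛ (λ K → ⟪ isFlat ρ K ⟫ ⟪ K ∈ᵇ[ A , C ] ⟫ ∑[ B , D ] (f K))
      ≡⟨ ∑ₛ-cong (λ K → ∑ₛ-guard² (isFlat ρ K) (K ∈ᵇ[ A , C ]) _) ⟩
    ∑ₛ (λ K → ∑ₛ (λ L → ⟪ isFlat ρ K ⟫ ⟪ K ∈ᵇ[ A , C ] ⟫ ⟪ isFlat ρ L ⟫ ⟪ L ∈ᵇ[ B , D ] ⟫ f K L))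
      ≡⟨ ∑ₛ-swap _ ⟩
    ∑ₛ (λ L → ∑ₛ (λ K → ⟪ isFlat ρ K ⟫ ⟪ K ∈ᵇ[ A , C ] ⟫ ⟪ isFlat ρ L ⟫ ⟪ L ∈ᵇ[ B , D ] ⟫ f K L))
      ≡⟨ ∑ₛ-cong (λ L → ∑ₛ-cong λ K →
           guard²-swap (isFlat ρ K) (K ∈ᵇ[ A , C ]) (isFlat ρ L) (L ∈ᵇ[ B , D ]) (f K L)) ⟩
    ∑ₛ (λ L → ∑ₛ (λ K → ⟪ isFlat ρ L ⟫ ⟪ L ∈ᵇ[ B , D ] ⟫ ⟪ isFlat ρ K ⟫ ⟪ K ∈ᵇ[ A , C ] ⟫ f K L))
      ≡⟨ ∑ₛ-cong (λ L → sym (∑ₛ-guard² (isFlat ρ L) (L ∈ᵇ[ B , D ]) _)) ⟩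
    ∑[ B , D ] (λ L → ∑[ A , C ] (λ K → f K L)) ∎
    where open ≡-Reasoning

  -- Both sides sum over the chains A ≤ B ≤ G ≤ C of flats.
  ∑[]-Fubini : ∀ A C (f : Subset n → Subset n → ℤ) →
    ∑[ A , C ] (λ B → ∑[ B , C ] (f B)) ≡ ∑[ A , C ] (λ G → ∑[ A , G ] (λ B → f B G))
  ∑[]-Fubini A C f = begin
    ∑ₛ (λ B → ⟪ isFlat ρ B ⟫ ⟪ B ∈ᵇ[ A , C ] ⟫ ∑[ B , C ] (f B))
      ≡⟨ ∑ₛ-cong (λ B → ∑ₛ-guard² (isFlat ρ B) (B ∈ᵇ[ A , C ]) _) ⟩
    ∑ₛ (λ B → ∑ₛ (λ G → ⟪ isFlat ρ B ⟫ ⟪ B ∈ᵇ[ A , C ] ⟫ ⟪ isFlat ρ G ⟫ ⟪ G ∈ᵇ[ B , C ] ⟫ f B G))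
      ≡⟨ ∑ₛ-swap _ ⟩
    ∑ₛ (λ G → ∑ₛ (λ B → ⟪ isFlat ρ B ⟫ ⟪ B ∈ᵇ[ A , C ] ⟫ ⟪ isFlat ρ G ⟫ ⟪ G ∈ᵇ[ B , C ] ⟫ f B G))
      ≡⟨ ∑ₛ-cong (λ G → ∑ₛ-cong λ B → regroup B G) ⟩
    ∑ₛ (λ G → ∑ₛ (λ B → ⟪ isFlat ρ G ⟫ ⟪ G ∈ᵇ[ A , C ] ⟫ ⟪ isFlat ρ B ⟫ ⟪ B ∈ᵇ[ A , G ] ⟫ f B G))
      ≡⟨ ∑ₛ-cong (λ G → sym (∑ₛ-guard² (isFlat ρ G) (G ∈ᵇ[ A , C ]) _)) ⟩
    ∑[ A , C ] (λ G → ∑[ A , G ] (λ B → f B G)) ∎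
    where
    open ≡-Reasoning
    chain : ∀ B G → ((B ∈ᵇ[ A , C ]) ∧ (G ∈ᵇ[ B , C ])) ≡ ((G ∈ᵇ[ A , C ]) ∧ (B ∈ᵇ[ A , G ]))
    chain B G = Bool-ext
      (λ h → let (A⊆B , _ , B⊆G , G⊆C) = ∧⁴-true⁻ {A ⊆ᵇ B} {B ⊆ᵇ C} {B ⊆ᵇ G} {G ⊆ᵇ C} h
             in  ∧⁴-true⁺ (⊆ᵇ-trans A B G A⊆B B⊆G) G⊆C A⊆B B⊆G)
      (λ h → let (_ , G⊆C , A⊆B , B⊆G) = ∧⁴-true⁻ {A ⊆ᵇ G} {G ⊆ᵇ C} {A ⊆ᵇ B} {B ⊆ᵇ G} h
             in  ∧⁴-true⁺ A⊆B (⊆ᵇ-trans B G C B⊆G G⊆C) B⊆G G⊆C)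
    regroup : ∀ B G →
      ⟪ isFlat ρ B ⟫ ⟪ B ∈ᵇ[ A , C ] ⟫ ⟪ isFlat ρ G ⟫ ⟪ G ∈ᵇ[ B , C ] ⟫ f B G ≡
      ⟪ isFlat ρ G ⟫ ⟪ G ∈ᵇ[ A , C ] ⟫ ⟪ isFlat ρ B ⟫ ⟪ B ∈ᵇ[ A , G ] ⟫ f B G
    regroup B G = trans (guard⁴ (isFlat ρ B) (B ∈ᵇ[ A , C ]) (isFlat ρ G) (G ∈ᵇ[ B , C ]) (f B G))
      (trans (cong (⟪_⟫ f B G) (cong₂ _∧_ (BoolP.∧-comm (isFlat ρ B) (isFlat ρ G)) (chain B G)))
             (sym (guard⁴ (isFlat ρ G) (G ∈ᵇ[ A , C ]) (isFlat ρ B) (B ∈ᵇ[ A , G ]) (f B G))))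

  ∑[]-point : ∀ {A B C} (f : Subset n → ℤ) → flat B → A ⊆ B → B ⊆ C →
    ∑[ A , C ] (λ K → ⟪ K == B ⟫ f K) ≡ f B
  ∑[]-point {A} {B} {C} f fB A⊆B B⊆C =
    trans (∑ₛ-cong λ K → sym (guard-rotate (K == B) (isFlat ρ K) (K ∈ᵇ[ A , C ]) (f K)))
          (trans (∑ₛ-point B (λ K → ⟪ isFlat ρ K ⟫ ⟪ K ∈ᵇ[ A , C ] ⟫ f K))
                 (cong₂ (λ a b → ⟪ a ⟫ ⟪ b ⟫ f B) fB (∧-true⁺ (⊆ᵇ⁺ A⊆B) (⊆ᵇ⁺ B⊆C))))

  ∑[]-split : ∀ {A B C} (f : Subset n → ℤ) → flat B → A ⊆ B → B ⊆ C →
    ∑[ A , C ] f ≡ f B + ∑[ A , C ] (λ K → ⟪ not (K == B) ⟫ f K)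
  ∑[]-split {A} {B} {C} f fB A⊆B B⊆C =
    trans (∑[]-cong A C {g = λ K → ⟪ K == B ⟫ f K + ⟪ not (K == B) ⟫ f K}
                    (λ K _ _ _ → guard-split true (K == B) (f K)))
          (trans (∑[]-+ A C (λ K → ⟪ K == B ⟫ f K) (λ K → ⟪ not (K == B) ⟫ f K))
                 (cong (_+ ∑[ A , C ] (λ K → ⟪ not (K == B) ⟫ f K)) (∑[]-point f fB A⊆B B⊆C)))

  ∑[]-singleton : ∀ A (f : Subset n → ℤ) → flat A → ∑[ A , A ] f ≡ f A
  ∑[]-singleton A f fA =
    trans (∑[]-cong A A (λ K _ A⊆K K⊆A → sym (cong (⟪_⟫ f K) (==⁺ (SubsetP.⊆-antisym K⊆A A⊆K)))))
          (∑[]-point f fA SubsetP.⊆-refl SubsetP.⊆-refl)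

  halfOpen : Subset n → Subset n → Subset n → Bool
  halfOpen A C H = A ⊆ᵇ H ∧ H ⊆ᵇ C ∧ not (H == C)

  mobiusF-⊈ : ∀ k A C → ¬ A ⊆ C → mobiusF ρ k A C ≡ 0ℤ
  mobiusF-⊈ zero    A C A⊈C = refl
  mobiusF-⊈ (suc k) A C A⊈C with A ⊆? C
  ... | yes A⊆C = ⊥-elim (A⊈C A⊆C)
  ... | no _    = refl

  mobiusF-refl : ∀ k A → mobiusF ρ (suc k) A A ≡ 1ℤ
  mobiusF-refl k A with A ⊆? A
  ... | no A⊈A = ⊥-elim (A⊈A SubsetP.⊆-refl)
  ... | yes _ with VecP.≡-dec Bool._≟_ A A
  ...   | yes _   = refl
  ...   | no A≢A  = ⊥-elim (A≢A refl)

  mobiusF-rec : ∀ k A C → A ⊆ C → ¬ A ≡ C →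
    mobiusF ρ (suc k) A C ≡ - ∑ₛ (λ H → ⟪ isFlat ρ H ⟫ ⟪ halfOpen A C H ⟫ mobiusF ρ k A H)
  mobiusF-rec k A C A⊆C A≢C with A ⊆? C
  ... | no A⊈C = ⊥-elim (A⊈C A⊆C)
  ... | yes _ with VecP.≡-dec Bool._≟_ A C
  ...   | yes A≡C = ⊥-elim (A≢C A≡C)
  ...   | no _    = cong -_ (∑-flats-filter ρ (halfOpen A C) (mobiusF ρ k A))

  mobiusF-fuel : ∀ k k′ A C → ∣ C ∣ < k → ∣ C ∣ < k′ → mobiusF ρ k A C ≡ mobiusF ρ k′ A C
  mobiusF-fuel (suc k) (suc k′) A C ∣C∣<k ∣C∣<k′ with A ⊆? C
  ... | no _ = refl
  ... | yes _ with VecP.≡-dec Bool._≟_ A C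
  ...   | yes _ = refl
  ...   | no _ = cong -_ (trans (∑-flats-filter ρ (halfOpen A C) (mobiusF ρ k A))
                                (trans (∑ₛ-cong λ H → cong (⟪ isFlat ρ H ⟫_) (below H))
                                       (sym (∑-flats-filter ρ (halfOpen A C) (mobiusF ρ k′ A)))))
    where
    below : ∀ H → ⟪ halfOpen A C H ⟫ mobiusF ρ k A H ≡ ⟪ halfOpen A C H ⟫ mobiusF ρ k′ A H
    below H with H ⊆? C | VecP.≡-dec Bool._≟_ H C
    ... | yes H⊆C | no H≢C = cong (⟪ A ⊆ᵇ H ∧ true ∧ true ⟫_)
            (mobiusF-fuel k k′ A H (ℕP.<-≤-trans (⊂-card H⊆C H≢C) (ℕP.≤-pred ∣C∣<k))
                                   (ℕP.<-≤-trans (⊂-card H⊆C H≢C) (ℕP.≤-pred ∣C∣<k′)))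
    ... | yes _ | yes _ rewrite BoolP.∧-zeroʳ (A ⊆ᵇ H) = refl
    ... | no _  | _     rewrite BoolP.∧-zeroʳ (A ⊆ᵇ H) = refl

  μ : Subset n → Subset n → ℤ
  μ = mobius ρ

  mobius-refl : ∀ A → μ A A ≡ 1ℤ
  mobius-refl = mobiusF-refl n

  mobius-rec : ∀ {A C} → A ⊆ C → ¬ A ≡ C → μ A C ≡ - ∑[ A , C ] (λ H → ⟪ not (H == C) ⟫ μ A H)
  mobius-rec {A} {C} A⊆C A≢C = trans (mobiusF-rec n A C A⊆C A≢C) (cong -_ (∑ₛ-cong λ H →
    cong (⟪ isFlat ρ H ⟫_) (trans (guard-cong (halfOpen A C H) (fuel H)) (reassociate H))))
    where
    reassociate : ∀ H → ⟪ halfOpen A C H ⟫ μ A H ≡ ⟪ H ∈ᵇ[ A , C ] ⟫ ⟪ not (H == C) ⟫ μ A H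
    reassociate H = sym (trans (guard-∧ (H ∈ᵇ[ A , C ]) _ _)
                               (cong (⟪_⟫ μ A H) (BoolP.∧-assoc (A ⊆ᵇ H) (H ⊆ᵇ C) (not (H == C)))))
    fuel : ∀ H → halfOpen A C H ≡ true → mobiusF ρ n A H ≡ μ A H
    fuel H h = mobiusF-fuel n (suc n) A H ∣H∣<n (ℕP.m<n⇒m<1+n ∣H∣<n)
      where
      H⊆C∧H≢C : H ⊆ᵇ C ∧ not (H == C) ≡ true
      H⊆C∧H≢C = ∧-trueʳ {A ⊆ᵇ H} h
      ∣H∣<n : ∣ H ∣ < n
      ∣H∣<n = ℕP.<-≤-trans (⊂-card {H = H} {C} (⊆ᵇ⁻ (∧-trueˡ {H ⊆ᵇ C} H⊆C∧H≢C))
                                  (not-true⇒≢true (∧-trueʳ {H ⊆ᵇ C} H⊆C∧H≢C) ∘ ==⁺))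
                           (SubsetP.∣p∣≤n C)

-- Matroids: closure, contraction and intervals

module Matroid {n : ℕ} (ρ : RankFn n) (isM : IsMatroid ρ) where
  open IsMatroid isM
  open Flats ρ public

  r : ℕ
  r = ρ ⊤

  mono : ∀ {X Y} → X ⊆ Y → ρ X ≤ ρ Y
  mono {X} {Y} = monotone X Y

  ρ≤r : ∀ X → ρ X ≤ r
  ρ≤r X = mono SubsetP.⊆⊤

  dependent-mono : ∀ {X Y} e → Y ⊆ X → ρ (Y ∪ ⁅ e ⁆) ≡ ρ Y → ρ (X ∪ ⁅ e ⁆) ≡ ρ X
  dependent-mono {X} {Y} e Y⊆X ρYe≡ρY =
    ℕP.≤-antisym (ℕP.≤-trans (mono X∪e⊆X∪Ye) (ℕP.+-cancelʳ-≤ (ρ (X ∩ Ye)) (ρ (X ∪ Ye)) (ρ X) submodularity))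
                 (mono (⊆-∪ˡ X ⁅ e ⁆))
    where
    Ye = Y ∪ ⁅ e ⁆
    X∪e⊆X∪Ye : X ∪ ⁅ e ⁆ ⊆ X ∪ Ye
    X∪e⊆X∪Ye = ∪-lub (⊆-∪ˡ X Ye) (⊆-trans (⊆-∪ʳ Y ⁅ e ⁆) (⊆-∪ʳ X Ye))
    submodularity : ρ (X ∪ Ye) ℕ.+ ρ (X ∩ Ye) ≤ ρ X ℕ.+ ρ (X ∩ Ye)
    submodularity = begin
      ρ (X ∪ Ye) ℕ.+ ρ (X ∩ Ye) ≤⟨ submodular X Ye ⟩
      ρ X ℕ.+ ρ Ye              ≡⟨ cong (ρ X ℕ.+_) ρYe≡ρY ⟩
      ρ X ℕ.+ ρ Y               ≤⟨ ℕP.+-monoʳ-≤ (ρ X) (mono (∩-glb Y⊆X (⊆-∪ˡ Y ⁅ e ⁆))) ⟩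
      ρ X ℕ.+ ρ (X ∩ Ye)        ∎
      where open ℕP.≤-Reasoning

  flat-closed : ∀ {F Y} e → flat F → Y ⊆ F → ρ (Y ∪ ⁅ e ⁆) ≡ ρ Y → e ∈ F
  flat-closed {F} e fF Y⊆F ρYe≡ρY with e ∈? F
  ... | yes e∈F = e∈F
  ... | no e∉F  = ⊥-elim (flat⇒rank-jumps fF e e∉F (dependent-mono e Y⊆F ρYe≡ρY))

  flat-⊂⇒rank< : ∀ {F G} → flat F → F ⊆ G → ¬ F ≡ G → ρ F < ρ G
  flat-⊂⇒rank< {F} {G} fF F⊆G F≢G with ⊆-witness {B = G} {F} (F≢G ∘ SubsetP.⊆-antisym F⊆G)
  ... | x , x∈G , x∉F = ℕP.<-≤-trans (ℕP.≤∧≢⇒< (mono (⊆-∪ˡ F ⁅ x ⁆)) (flat⇒rank-jumps fF x x∉F ∘ sym))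
                                     (mono (∪-lub F⊆G (⁅⁆-⊆ x∈G)))

  flat-full-rank⇒⊤ : ∀ {F} → flat F → ρ F ≡ r → F ≡ ⊤
  flat-full-rank⇒⊤ {F} fF ρF≡r with VecP.≡-dec Bool._≟_ F ⊤
  ... | yes F≡⊤ = F≡⊤
  ... | no F≢⊤  = ⊥-elim (ℕP.<-irrefl ρF≡r (flat-⊂⇒rank< fF SubsetP.⊆⊤ F≢⊤))

  ρ-empty : ρ ⊥ ≡ 0
  ρ-empty = ℕP.n≤0⇒n≡0 (subst (ρ ⊥ ≤_) (SubsetP.∣⊥∣≡0 n) (bounded ⊥))

  ∈bot⁻ : ∀ {e} → e ∈ bot ρ → ρ (⊥ ∪ ⁅ e ⁆) ≡ ρ ⊥
  ∈bot⁻ {e} h = ℕP.≡ᵇ⇒≡ _ _ (true⇒T (∈-tabulate⁻ _ e h))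

  ∈bot⁺ : ∀ {e} → ρ (⊥ ∪ ⁅ e ⁆) ≡ ρ ⊥ → e ∈ bot ρ
  ∈bot⁺ {e} h = ∈-tabulate⁺ _ e (≡ᵇ-true h)

  bot-⊆-flat : ∀ {F} → flat F → bot ρ ⊆ F
  bot-⊆-flat {F} fF {e} e∈bot = flat-closed e fF (SubsetP.⊆-min F) (∈bot⁻ e∈bot)

  fromList : List (Fin n) → Subset n
  fromList = foldr (λ e S → ⁅ e ⁆ ∪ S) ⊥

  ∈fromList : ∀ {e} es → e ListM.∈ es → e ∈ fromList es
  ∈fromList (x ∷ es) (here refl) = ⊆-∪ˡ ⁅ x ⁆ (fromList es) (SubsetP.x∈⁅x⁆ x)
  ∈fromList (x ∷ es) (there m) = ⊆-∪ʳ ⁅ x ⁆ (fromList es) (∈fromList es m)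

  rank-∪-dependent : ∀ X es → (∀ e → e ListM.∈ es → ρ (X ∪ ⁅ e ⁆) ≡ ρ X) → ρ (X ∪ fromList es) ≡ ρ X
  rank-∪-dependent X []       h = cong ρ (SubsetP.∪-identityʳ X)
  rank-∪-dependent X (e ∷ es) h = begin
    ρ (X ∪ (⁅ e ⁆ ∪ fromList es))  ≡⟨ cong ρ (trans (cong (X ∪_) (SubsetP.∪-comm ⁅ e ⁆ (fromList es)))
                                                      (sym (SubsetP.∪-assoc X (fromList es) ⁅ e ⁆))) ⟩
    ρ ((X ∪ fromList es) ∪ ⁅ e ⁆)  ≡⟨ dependent-mono e (⊆-∪ˡ X (fromList es)) (h e (here refl)) ⟩
    ρ (X ∪ fromList es)            ≡⟨ rank-∪-dependent X es (λ e′ e′∈es → h e′ (there e′∈es)) ⟩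
    ρ X                            ∎
    where open ≡-Reasoning

  ρ-bot : ρ (bot ρ) ≡ 0
  ρ-bot = ℕP.n≤0⇒n≡0 (ℕP.≤-trans (mono bot⊆) (ℕP.≤-reflexive (trans (rank-∪-dependent ⊥ loops dependent) ρ-empty)))
    where
    loops = filter (_∈? bot ρ) (allFin n)
    dependent : ∀ e → e ListM.∈ loops → ρ (⊥ ∪ ⁅ e ⁆) ≡ ρ ⊥
    dependent e e∈loops = ∈bot⁻ (proj₂ (ListMP.∈-filter⁻ (_∈? bot ρ) {xs = allFin n} e∈loops))
    bot⊆ : bot ρ ⊆ ⊥ ∪ fromList loops
    bot⊆ {e} e∈bot = ⊆-∪ʳ ⊥ (fromList loops) (∈fromList loops (ListMP.∈-filter⁺ (_∈? bot ρ) (ListMP.∈-allFin e) e∈bot))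

  bot-flat : flat (bot ρ)
  bot-flat = rank-jumps⇒flat λ e e∉bot ρbot∪e≡ρbot → e∉bot (∈bot⁺ (ℕP.≤-antisym
    (ℕP.≤-trans (mono (∪-lub (SubsetP.⊆-min _) (⊆-∪ʳ (bot ρ) ⁅ e ⁆)))
                (ℕP.≤-reflexive (trans ρbot∪e≡ρbot (trans ρ-bot (sym ρ-empty)))))
    (mono (⊆-∪ˡ ⊥ ⁅ e ⁆))))

  ρ-antisym : ∀ {A B : Subset n} → A ⊆ B → B ⊆ A → ρ A ≡ ρ B
  ρ-antisym A⊆B B⊆A = cong ρ (SubsetP.⊆-antisym A⊆B B⊆A)

  ∪-absorbs : ∀ {A F : Subset n} → F ⊆ A → A ∪ F ⊆ A
  ∪-absorbs F⊆A = ∪-lub (λ h → h) F⊆A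

  con-flat : ∀ F X → isFlat (con ρ F) X ≡ isFlat ρ X ∧ F ⊆ᵇ X
  con-flat F X with F ⊆? X
  ... | yes F⊆X rewrite BoolP.∧-identityʳ (isFlat ρ X) = Bool-ext to from
    where
    absorbs-F : ∀ Y → X ⊆ Y → ρ (Y ∪ F) ≡ ρ Y
    absorbs-F Y X⊆Y = ρ-antisym (∪-absorbs (⊆-trans F⊆X X⊆Y)) (⊆-∪ˡ Y F)
    to : Flats.flat (con ρ F) X → flat X
    to flat-in-M/F = rank-jumps⇒flat λ e e∉X same-rank → Flats.flat⇒rank-jumps (con ρ F) flat-in-M/F e e∉X
      (cong (_∸ ρ F) (trans (absorbs-F _ (⊆-∪ˡ X ⁅ e ⁆)) (trans same-rank (sym (absorbs-F X SubsetP.⊆-refl)))))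
    from : flat X → Flats.flat (con ρ F) X
    from fX = Flats.rank-jumps⇒flat (con ρ F) λ e e∉X same-rank → flat⇒rank-jumps fX e e∉X
      (trans (sym (absorbs-F _ (⊆-∪ˡ X ⁅ e ⁆)))
             (trans (ℕP.∸-cancelʳ-≡ (mono (⊆-∪ʳ _ F)) (mono (⊆-∪ʳ X F)) same-rank) (absorbs-F X SubsetP.⊆-refl)))
  ... | no F⊈X rewrite BoolP.∧-zeroʳ (isFlat ρ X) = ≢true⇒false λ flat-in-M/F →
    let (e , e∈F , e∉X) = ⊆-witness F⊈X in
    Flats.flat⇒rank-jumps (con ρ F) flat-in-M/F e e∉X (cong (_∸ ρ F) (ρ-antisym
      (∪-lub (∪-lub (⊆-∪ˡ X F) (⁅⁆-⊆ (⊆-∪ʳ X F e∈F))) (⊆-∪ʳ X F))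
      (∪-lub (⊆-trans (⊆-∪ˡ X ⁅ e ⁆) (⊆-∪ˡ _ F)) (⊆-∪ʳ _ F))))

  con-bot : ∀ {F} → flat F → bot (con ρ F) ≡ F
  con-bot {F} fF = SubsetP.⊆-antisym to from
    where
    ρ⊥∪F : ρ (⊥ ∪ F) ≡ ρ F
    ρ⊥∪F = cong ρ (SubsetP.∪-identityˡ F)
    to : bot (con ρ F) ⊆ F
    to {e} e∈bot = flat-closed e fF SubsetP.⊆-refl (ℕP.≤-antisym (begin
      ρ (F ∪ ⁅ e ⁆)          ≤⟨ mono (∪-lub (⊆-∪ʳ (⊥ ∪ ⁅ e ⁆) F) (⊆-trans (⊆-∪ʳ ⊥ ⁅ e ⁆) (⊆-∪ˡ _ F))) ⟩
      ρ ((⊥ ∪ ⁅ e ⁆) ∪ F)    ≡⟨ ℕP.∸-cancelʳ-≡ (mono (⊆-∪ʳ _ F)) (mono (⊆-∪ʳ ⊥ F)) (≡ᵇ-true⁻ (∈-tabulate⁻ _ e e∈bot)) ⟩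
      ρ (⊥ ∪ F)              ≡⟨ ρ⊥∪F ⟩
      ρ F                    ∎) (mono (⊆-∪ˡ F ⁅ e ⁆)))
      where open ℕP.≤-Reasoning
    from : F ⊆ bot (con ρ F)
    from {e} e∈F = ∈-tabulate⁺ _ e (≡ᵇ-true (cong (_∸ ρ F) (trans
      (ρ-antisym (∪-lub (∪-lub (SubsetP.⊆-min F) (⁅⁆-⊆ e∈F)) SubsetP.⊆-refl) (⊆-∪ʳ _ F))
      (sym ρ⊥∪F))))

  con-rank : ∀ F → rank (con ρ F) ≡ r ∸ ρ F
  con-rank F = cong (λ X → ρ X ∸ ρ F) (SubsetP.∪-zeroˡ F)

  con-con : ∀ {F G} → F ⊆ G → ∀ X → con (con ρ F) G X ≡ con ρ G X
  con-con {F} {G} F⊆G X =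
    trans (cong₂ (λ A B → (ρ A ∸ ρ F) ∸ (ρ B ∸ ρ F))
                 (SubsetP.⊆-antisym (∪-absorbs (⊆-trans F⊆G (⊆-∪ʳ X G))) (⊆-∪ˡ _ F))
                 (SubsetP.⊆-antisym (∪-absorbs F⊆G) (⊆-∪ˡ G F)))
          ([a∸c]∸[b∸c]≡a∸b _ (mono F⊆G))

  d : Subset n → ℕ
  d F = r ∸ ρ F

  -- κ F G q is q multiplied by the characteristic polynomial of the interval [F, G],
  -- κ̄ F G q is q multiplied by its reversal t^(rk G - rk F) χ(t⁻¹).
  κ : Subset n → Subset n → Poly → Poly
  κ F G q i = ∑[ F , G ] (λ K → μ F K * shift (ρ G ∸ ρ K) q i)

  κ̄ : Subset n → Subset n → Poly → Poly
  κ̄ F G q i = ∑[ F , G ] (λ K → μ F K * shift (ρ K ∸ ρ F) q i)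

  -- τ is the matroid (M^F)_G, whose loops are F ∪ ∁ G: its flats are the sets Y ∪ ∁ G
  -- with Y a flat of M in [F, G], so χ_τ is the characteristic polynomial of [F, G].
  module Interval (F G : Subset n) (fF : flat F) (fG : flat G) (F⊆G : F ⊆ G) where
    τ : RankFn n
    τ = loc (con ρ F) G

    τ-unchanged : ∀ X e → (e ∉ G ⊎ e ∈ F) → τ (X ∪ ⁅ e ⁆) ≡ τ X
    τ-unchanged X e c = cong (_∸ ρ F) (ρ-antisym (to c) from)
      where
      to : (e ∉ G ⊎ e ∈ F) → ((X ∪ ⁅ e ⁆) ∩ G) ∪ F ⊆ (X ∩ G) ∪ F
      to c {y} h with SubsetP.x∈p∪q⁻ _ F h
      ... | inj₂ y∈F = ⊆-∪ʳ _ F y∈F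
      ... | inj₁ y∈[X∪e]∩G with SubsetP.x∈p∩q⁻ _ G y∈[X∪e]∩G
      ...   | (y∈X∪e , y∈G) with SubsetP.x∈p∪q⁻ X ⁅ e ⁆ y∈X∪e | c
      ...     | inj₁ y∈X | _ = ⊆-∪ˡ _ F (SubsetP.x∈p∩q⁺ (y∈X , y∈G))
      ...     | inj₂ y∈e | inj₁ e∉G = ⊥-elim (e∉G (subst (_∈ G) (SubsetP.x∈⁅y⁆⇒x≡y e y∈e) y∈G))
      ...     | inj₂ y∈e | inj₂ e∈F = ⊆-∪ʳ _ F (⁅⁆-⊆ e∈F y∈e)
      from : (X ∩ G) ∪ F ⊆ ((X ∪ ⁅ e ⁆) ∩ G) ∪ F
      from = ∪-lub (⊆-trans (∩-glb (⊆-trans (∩-⊆ˡ X G) (⊆-∪ˡ X ⁅ e ⁆)) (∩-⊆ʳ X G)) (⊆-∪ˡ _ F)) (⊆-∪ʳ _ F)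

    τ-on : ∀ X → F ⊆ X ∩ G → τ X ≡ ρ (X ∩ G) ∸ ρ F
    τ-on X F⊆X∩G = cong (_∸ ρ F) (ρ-antisym (∪-absorbs F⊆X∩G) (⊆-∪ˡ _ F))

    τ-on-∪ : ∀ X e → F ⊆ X ∩ G → e ∈ G → τ (X ∪ ⁅ e ⁆) ≡ ρ ((X ∩ G) ∪ ⁅ e ⁆) ∸ ρ F
    τ-on-∪ X e F⊆X∩G e∈G = cong (_∸ ρ F) (ρ-antisym to from)
      where
      to : ((X ∪ ⁅ e ⁆) ∩ G) ∪ F ⊆ (X ∩ G) ∪ ⁅ e ⁆
      to {y} h with SubsetP.x∈p∪q⁻ _ F h
      ... | inj₂ y∈F = ⊆-∪ˡ _ ⁅ e ⁆ (F⊆X∩G y∈F)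
      ... | inj₁ y∈[X∪e]∩G with SubsetP.x∈p∩q⁻ _ G y∈[X∪e]∩G
      ...   | (y∈X∪e , y∈G) with SubsetP.x∈p∪q⁻ X ⁅ e ⁆ y∈X∪e
      ...     | inj₁ y∈X = ⊆-∪ˡ _ ⁅ e ⁆ (SubsetP.x∈p∩q⁺ (y∈X , y∈G))
      ...     | inj₂ y∈e = ⊆-∪ʳ _ ⁅ e ⁆ y∈e
      from : (X ∩ G) ∪ ⁅ e ⁆ ⊆ ((X ∪ ⁅ e ⁆) ∩ G) ∪ F
      from = ∪-lub (⊆-trans (∩-glb (⊆-trans (∩-⊆ˡ X G) (⊆-∪ˡ X ⁅ e ⁆)) (∩-⊆ʳ X G)) (⊆-∪ˡ _ F))
               (λ {y} y∈e → ⊆-∪ˡ _ F (SubsetP.x∈p∩q⁺ (⊆-∪ʳ X ⁅ e ⁆ y∈e , ⁅⁆-⊆ e∈G y∈e)))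

    τ-isFlat : ∀ X → isFlat τ X ≡ (∁ G) ⊆ᵇ X ∧ (isFlat ρ (X ∩ G) ∧ F ⊆ᵇ (X ∩ G))
    τ-isFlat X with ∁ G ⊆? X
    ... | no ∁G⊈X = ≢true⇒false λ flat-in-τ → let (e , e∈∁G , e∉X) = ⊆-witness {B = ∁ G} {X} ∁G⊈X in
          Flats.flat⇒rank-jumps τ flat-in-τ e e∉X (τ-unchanged X e (inj₁ (SubsetP.x∈∁p⇒x∉p e∈∁G)))
    ... | yes ∁G⊆X with F ⊆? X ∩ G
    ...   | no F⊈X∩G rewrite BoolP.∧-zeroʳ (isFlat ρ (X ∩ G)) = ≢true⇒false λ flat-in-τ →
            let (e , e∈F , e∉Y) = ⊆-witness {B = F} {X ∩ G} F⊈X∩G in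
            Flats.flat⇒rank-jumps τ flat-in-τ e (λ e∉X → e∉Y (SubsetP.x∈p∩q⁺ (e∉X , F⊆G e∈F))) (τ-unchanged X e (inj₂ e∈F))
    ...   | yes F⊆X∩G rewrite BoolP.∧-identityʳ (isFlat ρ (X ∩ G)) = Bool-ext to from
      where
      Y = X ∩ G
      inG : ∀ e → e ∉ X → e ∈ G
      inG e e∉X with e ∈? G
      ... | yes e∈G = e∈G
      ... | no e∉G  = ⊥-elim (e∉X (∁G⊆X (SubsetP.x∉p⇒x∈∁p e∉G)))
      to : Flats.flat τ X → flat Y
      to flat-in-τ = rank-jumps⇒flat λ e e∉Y eq → case e e∉Y eq
        where
        case : ∀ e → e ∉ Y → ¬ ρ (Y ∪ ⁅ e ⁆) ≡ ρ Y
        case e e∉Y eq with e ∈? G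
        ... | no e∉G = e∉G (flat-closed e fG (∩-⊆ʳ X G) eq)
        ... | yes e∈G = Flats.flat⇒rank-jumps τ flat-in-τ e (λ e∉X → e∉Y (SubsetP.x∈p∩q⁺ (e∉X , e∈G)))
                (trans (τ-on-∪ X e F⊆X∩G e∈G) (trans (cong (_∸ ρ F) eq) (sym (τ-on X F⊆X∩G))))
      from : flat Y → Flats.flat τ X
      from fY = Flats.rank-jumps⇒flat τ λ e e∉X eq → flat⇒rank-jumps fY e (λ e∉Y → e∉X (∩-⊆ˡ X G e∉Y))
        (ℕP.∸-cancelʳ-≡ (ℕP.≤-trans (mono F⊆X∩G) (mono (⊆-∪ˡ Y ⁅ e ⁆))) (mono F⊆X∩G)
          (trans (sym (τ-on-∪ X e F⊆X∩G (inG e e∉X))) (trans eq (τ-on X F⊆X∩G))))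

    τ-empty : τ ⊥ ≡ 0
    τ-empty = trans (cong (_∸ ρ F) (ρ-antisym (∪-lub (⊆-trans (∩-⊆ˡ ⊥ G) (SubsetP.⊆-min _)) SubsetP.⊆-refl)
                                              (⊆-∪ʳ _ F)))
                    (ℕP.n∸n≡0 (ρ F))

    τ-bot : bot τ ≡ F ∪ ∁ G
    τ-bot = SubsetP.⊆-antisym to from
      where
      to : bot τ ⊆ F ∪ ∁ G
      to {e} e∈bot with e ∈? G
      ... | no e∉G  = ⊆-∪ʳ F _ (SubsetP.x∉p⇒x∈∁p e∉G)
      ... | yes e∈G = ⊆-∪ˡ F _ (flat-closed e fF SubsetP.⊆-refl
                                  (ℕP.∸-cancelʳ-≡ (mono (⊆-∪ˡ F ⁅ e ⁆)) ℕP.≤-refl τ⁅e⁆≡0))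
        where
        F∪e≡ : F ∪ ⁅ e ⁆ ≡ ((⊥ ∪ ⁅ e ⁆) ∩ G) ∪ F
        F∪e≡ = SubsetP.⊆-antisym
          (∪-lub (⊆-∪ʳ _ F) (λ y∈e → ⊆-∪ˡ _ F (SubsetP.x∈p∩q⁺ (⊆-∪ʳ ⊥ ⁅ e ⁆ y∈e , ⁅⁆-⊆ e∈G y∈e))))
          (∪-lub (⊆-trans (∩-⊆ˡ _ G) (∪-lub (SubsetP.⊆-min _) (⊆-∪ʳ F ⁅ e ⁆))) (⊆-∪ˡ F ⁅ e ⁆))
        τ⁅e⁆≡0 : ρ (F ∪ ⁅ e ⁆) ∸ ρ F ≡ ρ F ∸ ρ F
        τ⁅e⁆≡0 = trans (cong (λ X → ρ X ∸ ρ F) F∪e≡)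
                       (trans (≡ᵇ-true⁻ (∈-tabulate⁻ _ e e∈bot)) (trans τ-empty (sym (ℕP.n∸n≡0 (ρ F)))))
      from : F ∪ ∁ G ⊆ bot τ
      from {e} e∈F∪∁G with SubsetP.x∈p∪q⁻ F (∁ G) e∈F∪∁G
      ... | inj₁ e∈F  = ∈-tabulate⁺ _ e (≡ᵇ-true (τ-unchanged ⊥ e (inj₂ e∈F)))
      ... | inj₂ e∈∁G = ∈-tabulate⁺ _ e (≡ᵇ-true (τ-unchanged ⊥ e (inj₁ (SubsetP.x∈∁p⇒x∉p e∈∁G))))

    ∪∁-∩-cancel : ∀ {Y} → Y ⊆ G → (Y ∪ ∁ G) ∩ G ≡ Y
    ∪∁-∩-cancel {Y} Y⊆G = SubsetP.⊆-antisym to (∩-glb (⊆-∪ˡ Y _) Y⊆G)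
      where
      to : (Y ∪ ∁ G) ∩ G ⊆ Y
      to {y} h with SubsetP.x∈p∩q⁻ _ G h
      ... | (a , y∈G) with SubsetP.x∈p∪q⁻ Y _ a
      ...   | inj₁ yY = yY
      ...   | inj₂ y∁ = ⊥-elim (SubsetP.x∈∁p⇒x∉p y∁ y∈G)

    τ-crk : ∀ {Y} → F ⊆ Y → Y ⊆ G → crk τ (Y ∪ ∁ G) ≡ ρ G ∸ ρ Y
    τ-crk {Y} F⊆X∩G Y⊆G = trans (cong₂ _∸_ (cong (_∸ ρ F) e1) (cong (_∸ ρ F) e2)) ([a∸c]∸[b∸c]≡a∸b _ (mono F⊆X∩G))
      where
      e1 : ρ ((⊤ ∩ G) ∪ F) ≡ ρ G
      e1 = ρ-antisym (∪-lub (∩-⊆ʳ ⊤ G) F⊆G) (⊆-trans (∩-glb SubsetP.⊆⊤ SubsetP.⊆-refl) (⊆-∪ˡ _ F))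
      e2 : ρ (((Y ∪ ∁ G) ∩ G) ∪ F) ≡ ρ Y
      e2 = trans (cong (λ z → ρ (z ∪ F)) (∪∁-∩-cancel Y⊆G)) (ρ-antisym (∪-absorbs F⊆X∩G) (⊆-∪ˡ Y F))

    τ-∑-flats : ∀ (h : Subset n → ℤ) → ∑ₛ (λ X → ⟪ isFlat τ X ⟫ h X) ≡ ∑[ F , G ] (λ Y → h (Y ∪ ∁ G))
    τ-∑-flats h =
      trans (∑ₛ-cong (λ X → trans (cong (⟪_⟫ h X) (τ-isFlat X)) (sym (guard-∧ (∁ G ⊆ᵇ X) _ (h X)))))
            (trans (∑ₛ-⊇∁ G (λ X → ⟪ isFlat ρ (X ∩ G) ∧ F ⊆ᵇ (X ∩ G) ⟫ h X)) (∑ₛ-cong below-G))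
      where
      below-G : ∀ Y → ⟪ Y ⊆ᵇ G ⟫ ⟪ isFlat ρ ((Y ∪ ∁ G) ∩ G) ∧ F ⊆ᵇ ((Y ∪ ∁ G) ∩ G) ⟫ h (Y ∪ ∁ G)
                    ≡ ⟪ isFlat ρ Y ⟫ ⟪ Y ∈ᵇ[ F , G ] ⟫ h (Y ∪ ∁ G)
      below-G Y with Y ⊆? G
      ... | no _ rewrite BoolP.∧-zeroʳ (F ⊆ᵇ Y) = sym (guard-0 (isFlat ρ Y))
      ... | yes Y⊆G rewrite ∪∁-∩-cancel Y⊆G | BoolP.∧-identityʳ (F ⊆ᵇ Y) =
        sym (guard-∧ (isFlat ρ Y) (F ⊆ᵇ Y) _)

    ∪∁-⊆⁻ : ∀ {A C : Subset n} → A ⊆ G → A ∪ ∁ G ⊆ C ∪ ∁ G → A ⊆ C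
    ∪∁-⊆⁻ {A} {C} A⊆G A∪∁G⊆C∪∁G {x} x∈A with SubsetP.x∈p∪q⁻ C (∁ G) (A∪∁G⊆C∪∁G (⊆-∪ˡ A _ x∈A))
    ... | inj₁ x∈C  = x∈C
    ... | inj₂ x∈∁G = ⊥-elim (SubsetP.x∈∁p⇒x∉p x∈∁G (A⊆G x∈A))

    ∪∁-⊆⁺ : ∀ {A C : Subset n} → A ⊆ C → A ∪ ∁ G ⊆ C ∪ ∁ G
    ∪∁-⊆⁺ {A} {C} A⊆C = ∪-lub (⊆-trans A⊆C (⊆-∪ˡ C _)) (⊆-∪ʳ C _)

    ∪∁-injective : ∀ {A C : Subset n} → A ⊆ G → C ⊆ G → A ∪ ∁ G ≡ C ∪ ∁ G → A ≡ C
    ∪∁-injective A⊆G C⊆G eq =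
      SubsetP.⊆-antisym (∪∁-⊆⁻ A⊆G (SubsetP.⊆-reflexive eq)) (∪∁-⊆⁻ C⊆G (SubsetP.⊆-reflexive (sym eq)))

    halfOpen-∪∁ : ∀ {A C Y : Subset n} → A ⊆ G → C ⊆ G → Y ⊆ G →
      Flats.halfOpen τ (A ∪ ∁ G) (C ∪ ∁ G) (Y ∪ ∁ G) ≡ Flats.halfOpen ρ A C Y
    halfOpen-∪∁ {A} {C} {Y} A⊆G C⊆G Y⊆G =
      cong₂ _∧_ (does-cong (_ ⊆? _) (A ⊆? Y) (∪∁-⊆⁻ A⊆G) ∪∁-⊆⁺)
        (cong₂ _∧_ (does-cong (_ ⊆? _) (Y ⊆? C) (∪∁-⊆⁻ Y⊆G) ∪∁-⊆⁺)
          (cong not (does-cong (VecP.≡-dec Bool._≟_ _ _) (VecP.≡-dec Bool._≟_ Y C)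
                               (∪∁-injective Y⊆G C⊆G) (cong (_∪ ∁ G)))))

    τ-mobiusF : ∀ k (A C : Subset n) → A ⊆ G → C ⊆ G → F ⊆ A →
      mobiusF τ k (A ∪ ∁ G) (C ∪ ∁ G) ≡ mobiusF ρ k A C
    τ-mobiusF zero    A C A⊆G C⊆G F⊆A = refl
    τ-mobiusF (suc k) A C A⊆G C⊆G F⊆A with A ⊆? C
    ... | no A⊈C = Flats.mobiusF-⊈ τ (suc k) _ _ (λ ⊆∪∁ → A⊈C (∪∁-⊆⁻ A⊆G ⊆∪∁))
    ... | yes A⊆C with VecP.≡-dec Bool._≟_ A C
    ...   | yes refl = Flats.mobiusF-refl τ k (A ∪ ∁ G)
    ...   | no A≢C = begin
      mobiusF τ (suc k) (A ∪ ∁ G) (C ∪ ∁ G)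
        ≡⟨ Flats.mobiusF-rec τ k _ _ (∪∁-⊆⁺ A⊆C) (A≢C ∘ ∪∁-injective A⊆G C⊆G) ⟩
      - ∑ₛ (λ H → ⟪ isFlat τ H ⟫ ⟪ halfOpenτ H ⟫ mobiusF τ k (A ∪ ∁ G) H)
        ≡⟨ cong -_ (τ-∑-flats (λ H → ⟪ halfOpenτ H ⟫ mobiusF τ k (A ∪ ∁ G) H)) ⟩
      - ∑[ F , G ] (λ Y → ⟪ halfOpenτ (Y ∪ ∁ G) ⟫ mobiusF τ k (A ∪ ∁ G) (Y ∪ ∁ G))
        ≡⟨ cong -_ (∑ₛ-cong (λ Y → cong (⟪ isFlat ρ Y ⟫_) (inner Y))) ⟩
      - ∑ₛ (λ Y → ⟪ isFlat ρ Y ⟫ ⟪ Flats.halfOpen ρ A C Y ⟫ mobiusF ρ k A Y)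
        ≡⟨ cong -_ (sym (∑-flats-filter ρ (Flats.halfOpen ρ A C) (mobiusF ρ k A))) ⟩
      - ∑ (filter (λ H → Bool.T? (Flats.halfOpen ρ A C H)) (flats ρ)) (mobiusF ρ k A) ∎
      where
      open ≡-Reasoning
      halfOpenτ : Subset n → Bool
      halfOpenτ = Flats.halfOpen τ (A ∪ ∁ G) (C ∪ ∁ G)
      inner : ∀ Y → ⟪ Y ∈ᵇ[ F , G ] ⟫ ⟪ halfOpenτ (Y ∪ ∁ G) ⟫ mobiusF τ k (A ∪ ∁ G) (Y ∪ ∁ G)
                  ≡ ⟪ Flats.halfOpen ρ A C Y ⟫ mobiusF ρ k A Y
      inner Y with Y ⊆? G
      ... | no Y⊈G rewrite BoolP.∧-zeroʳ (F ⊆ᵇ Y) | dec-false (Y ⊆? C) (λ Y⊆C → Y⊈G (⊆-trans Y⊆C C⊆G))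
                         | BoolP.∧-zeroʳ (A ⊆ᵇ Y) = refl
      ... | yes Y⊆G rewrite BoolP.∧-identityʳ (F ⊆ᵇ Y) | halfOpen-∪∁ {A} {C} {Y} A⊆G C⊆G Y⊆G
        with Flats.halfOpen ρ A C Y in Y∈[A,C⟩
      ...   | false = guard-0 (F ⊆ᵇ Y)
      ...   | true rewrite ⊆ᵇ⁺ (⊆-trans F⊆A (⊆ᵇ⁻ {A = A} {Y} (∧-trueˡ Y∈[A,C⟩))) = τ-mobiusF k A Y A⊆G Y⊆G F⊆A

    charPoly-*P : ∀ (q : Poly) i → (charPoly τ *P q) i ≡ κ F G q i
    charPoly-*P q i = begin
      (charPoly τ *P q) i
        ≡⟨ sumP-*P (flats τ) _ q i ⟩
      ∑ (flats τ) (λ X → (monoP (mobius τ (bot τ) X) (crk τ X) *P q) i)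
        ≡⟨ ∑-cong (flats τ) (λ X → monoP-*P (mobius τ (bot τ) X) (crk τ X) q i) ⟩
      ∑ (flats τ) (λ X → mobius τ (bot τ) X * shift (crk τ X) q i)
        ≡⟨ ∑ₛ-filter (isFlat τ) _ ⟩
      ∑ₛ (λ X → ⟪ isFlat τ X ⟫ (mobius τ (bot τ) X * shift (crk τ X) q i))
        ≡⟨ τ-∑-flats (λ X → mobius τ (bot τ) X * shift (crk τ X) q i) ⟩
      ∑[ F , G ] (λ Y → mobius τ (bot τ) (Y ∪ ∁ G) * shift (crk τ (Y ∪ ∁ G)) q i)
        ≡⟨ ∑[]-cong F G (λ Y _ F⊆Y Y⊆G → cong₂ (λ a b → a * shift b q i)
                                           (trans (cong (λ B → mobius τ B (Y ∪ ∁ G)) τ-bot)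
                                                  (τ-mobiusF (suc n) F Y F⊆G Y⊆G SubsetP.⊆-refl))
                                           (τ-crk F⊆Y Y⊆G)) ⟩
      κ F G q i ∎
      where open ≡-Reasoning

  -- Möbius inversion

  mobius-sumˡ : ∀ A {C} → flat C → ∑[ A , C ] (μ A) ≡ ⟪ A == C ⟫ 1ℤ
  mobius-sumˡ A {C} fC with A ⊆? C
  ... | no A⊈C = trans (∑[]-empty (μ A) A⊈C)
                       (sym (cong (⟪_⟫ 1ℤ) (==-false (λ A≡C → A⊈C (SubsetP.⊆-reflexive A≡C)))))
  ... | yes A⊆C with VecP.≡-dec Bool._≟_ A C
  ...   | yes refl = trans (∑[]-singleton A (μ A) fC) (mobius-refl A)
  ...   | no A≢C = begin
    ∑[ A , C ] (μ A)                                         ≡⟨ ∑[]-split (μ A) fC A⊆C SubsetP.⊆-refl ⟩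
    μ A C + ∑[ A , C ] (λ K → ⟪ not (K == C) ⟫ μ A K)         ≡⟨ cong (μ A C +_) (sym (ℤP.neg-involutive _)) ⟩
    μ A C + - - ∑[ A , C ] (λ K → ⟪ not (K == C) ⟫ μ A K)     ≡⟨ cong (λ z → μ A C + - z) (sym (mobius-rec A⊆C A≢C)) ⟩
    μ A C + - μ A C                                           ≡⟨ ℤP.+-inverseʳ (μ A C) ⟩
    0ℤ                                                        ∎
    where open ≡-Reasoning

  -- The left identity gives ∑[ A , C ] (λ B → μ A B * g B) = 0 for every flat A ⊆ C;
  -- since μ A A = 1, this determines g downwards from C, so g vanishes.
  module MobiusSumʳ (C : Subset n) (fC : flat C) where

    f g : Subset n → ℤ
    f A = ∑[ A , C ] (λ G → μ G C)
    g A = f A + - ⟪ A == C ⟫ 1ℤ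

    ∑μf : ∀ {A} → flat A → A ⊆ C → ∑[ A , C ] (λ B → μ A B * f B) ≡ μ A C
    ∑μf {A} fA A⊆C = begin
      ∑[ A , C ] (λ B → μ A B * f B)
        ≡⟨ ∑[]-cong A C (λ B _ _ _ → ∑[]-*ˡ B C (μ A B) _) ⟩
      ∑[ A , C ] (λ B → ∑[ B , C ] (λ G → μ A B * μ G C))
        ≡⟨ ∑[]-Fubini A C (λ B G → μ A B * μ G C) ⟩
      ∑[ A , C ] (λ G → ∑[ A , G ] (λ B → μ A B * μ G C))
        ≡⟨ ∑[]-cong A C (λ G fG _ _ → trans (∑[]-cong A G (λ B _ _ _ → ℤP.*-comm (μ A B) (μ G C)))
                                         (sym (∑[]-*ˡ A G (μ G C) (μ A)))) ⟩
      ∑[ A , C ] (λ G → μ G C * ∑[ A , G ] (μ A))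
        ≡⟨ ∑[]-cong A C (λ G fG _ _ → trans (cong (μ G C *_) (mobius-sumˡ A fG)) (*-indicator (μ G C) A G)) ⟩
      ∑[ A , C ] (λ G → ⟪ G == A ⟫ μ G C)
        ≡⟨ ∑[]-point (λ G → μ G C) fA SubsetP.⊆-refl A⊆C ⟩
      μ A C ∎
      where open ≡-Reasoning

    ∑μδ : ∀ {A} → A ⊆ C → ∑[ A , C ] (λ B → μ A B * ⟪ B == C ⟫ 1ℤ) ≡ μ A C
    ∑μδ {A} A⊆C = trans (∑[]-cong A C (λ B _ _ _ → trans (*-indicator (μ A B) B C) (cong (⟪_⟫ μ A B) (==-sym C B))))
                        (∑[]-point (μ A) fC A⊆C SubsetP.⊆-refl)

    ∑μg : ∀ {A} → flat A → A ⊆ C → ∑[ A , C ] (λ B → μ A B * g B) ≡ 0ℤ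
    ∑μg {A} fA A⊆C = begin
      ∑[ A , C ] (λ B → μ A B * g B)
        ≡⟨ ∑[]-cong A C (λ B _ _ _ → trans (ℤP.*-distribˡ-+ (μ A B) (f B) _)
                                       (cong (μ A B * f B +_) (sym (ℤP.neg-distribʳ-* (μ A B) _)))) ⟩
      ∑[ A , C ] (λ B → μ A B * f B + - (μ A B * ⟪ B == C ⟫ 1ℤ))
        ≡⟨ ∑[]-+ A C _ _ ⟩
      ∑[ A , C ] (λ B → μ A B * f B) + ∑[ A , C ] (λ B → - (μ A B * ⟪ B == C ⟫ 1ℤ))
        ≡⟨ cong₂ _+_ (∑μf fA A⊆C) (trans (sym (∑[]-neg A C _)) (cong -_ (∑μδ A⊆C))) ⟩
      μ A C + - μ A C
        ≡⟨ ℤP.+-inverseʳ (μ A C) ⟩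
      0ℤ ∎
      where open ≡-Reasoning

    g-vanishes : ∀ m A → n ∸ ∣ A ∣ < m → flat A → g A ≡ 0ℤ
    g-vanishes (suc m) A bound fA with A ⊆? C
    ... | no A⊈C = cong₂ (λ x b → x + - ⟪ b ⟫ 1ℤ) (∑[]-empty _ A⊈C)
                         (==-false (λ A≡C → A⊈C (SubsetP.⊆-reflexive A≡C)))
    ... | yes A⊆C = begin
      g A                  ≡⟨ sym (ℤP.*-identityˡ (g A)) ⟩
      1ℤ * g A             ≡⟨ cong (_* g A) (sym (mobius-refl A)) ⟩
      μ A A * g A          ≡⟨ sym (ℤP.+-identityʳ _) ⟩
      μ A A * g A + 0ℤ     ≡⟨ cong (μ A A * g A +_) (sym (∑[]-zero A C above)) ⟩
      μ A A * g A + ∑[ A , C ] (λ B → ⟪ not (B == A) ⟫ (μ A B * g B))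
                           ≡⟨ sym (∑[]-split (λ B → μ A B * g B) fA SubsetP.⊆-refl A⊆C) ⟩
      ∑[ A , C ] (λ B → μ A B * g B)
                           ≡⟨ ∑μg fA A⊆C ⟩
      0ℤ                   ∎
      where
      open ≡-Reasoning
      above : ∀ B → flat B → A ⊆ B → B ⊆ C → ⟪ not (B == A) ⟫ (μ A B * g B) ≡ 0ℤ
      above B fB A⊆B _ with B == A in B=A
      ... | true  = refl
      ... | false = trans (cong (μ A B *_) (g-vanishes m B smaller fB)) (ℤP.*-zeroʳ (μ A B))
        where
        smaller : n ∸ ∣ B ∣ < m
        smaller = ℕP.<-≤-trans (ℕP.∸-monoʳ-< (⊂-card A⊆B (λ A≡B → ==-false⁻ B=A (sym A≡B)))
                                            (SubsetP.∣p∣≤n B))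
                               (ℕP.≤-pred bound)

  mobius-sumʳ : ∀ {A C} → flat A → flat C → ∑[ A , C ] (λ G → μ G C) ≡ ⟪ A == C ⟫ 1ℤ
  mobius-sumʳ {A} {C} fA fC = ℤP.i-j≡0⇒i≡j _ _ (g-vanishes (suc (n ∸ ∣ A ∣)) A ℕP.≤-refl fA)
    where open MobiusSumʳ C fC

  -- The Kazhdan–Lusztig recursion

  ∑-con-flats : ∀ F (f : Subset n → ℤ) → ∑ₛ (λ G → ⟪ isFlat (con ρ F) G ⟫ f G) ≡ ∑[ F , ⊤ ] f
  ∑-con-flats F f = ∑ₛ-cong pointwise
    where
    pointwise : ∀ G → ⟪ isFlat (con ρ F) G ⟫ f G ≡ ⟪ isFlat ρ G ⟫ ⟪ G ∈ᵇ[ F , ⊤ ] ⟫ f G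
    pointwise G = trans (cong (⟪_⟫ f G) (con-flat F G))
      (trans (sym (guard-∧ (isFlat ρ G) (F ⊆ᵇ G) (f G)))
             (cong (λ b → ⟪ isFlat ρ G ⟫ ⟪ b ⟫ f G)
                   (sym (trans (cong (F ⊆ᵇ G ∧_) (⊆ᵇ⁺ {A = G} SubsetP.⊆⊤)) (BoolP.∧-identityʳ (F ⊆ᵇ G))))))

  d-mono : ∀ {F G} → flat F → F ⊆ G → ¬ G ≡ F → d G < d F
  d-mono {F} {G} fF F⊆G G≢F = ℕP.∸-monoʳ-< (flat-⊂⇒rank< fF F⊆G (G≢F ∘ sym)) (ρ≤r G)

  klF-top : ∀ k F → d F ≡ 0 → klF (suc k) (con ρ F) ≈ oneP
  klF-top k F dF≡0 i with rank (con ρ F) ℕ.≡ᵇ 0 in eq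
  ... | true  = refl
  ... | false with () ← trans (sym eq) (≡ᵇ-true (trans (con-rank F) dF≡0))

  klF-unfold : ∀ k F → flat F → ¬ d F ≡ 0 → ∀ i →
    klF (suc k) (con ρ F) i ≡
    ⟪ (2 ℕ.* i) ℕ.<ᵇ d F ⟫ (- ∑[ F , ⊤ ] (λ G → ⟪ not (G == F) ⟫ (charPoly (loc (con ρ F) G) *P klF k (con ρ G)) i))
  klF-unfold k F fF dF≢0 i with rank (con ρ F) ℕ.≡ᵇ 0 in eq
  ... | true  = ⊥-elim (dF≢0 (trans (sym (con-rank F)) (≡ᵇ-true⁻ eq)))
  ... | false = cong₂ (λ b z → ⟪ b ⟫ (- z)) (cong ((2 ℕ.* i) ℕ.<ᵇ_) (con-rank F)) (begin
    sumP L (λ G → charPoly (loc (con ρ F) G) *P klF k (con (con ρ F) G)) i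
      ≡⟨ sumP-coeff L _ i ⟩
    ∑ L (λ G → (charPoly (loc (con ρ F) G) *P klF k (con (con ρ F) G)) i)
      ≡⟨ ∑-flats-filter (con ρ F) (λ G → not (G == bot (con ρ F))) _ ⟩
    ∑ₛ (λ G → ⟪ isFlat (con ρ F) G ⟫ ⟪ not (G == bot (con ρ F)) ⟫
                (charPoly (loc (con ρ F) G) *P klF k (con (con ρ F) G)) i)
      ≡⟨ ∑-con-flats F _ ⟩
    ∑[ F , ⊤ ] (λ G → ⟪ not (G == bot (con ρ F)) ⟫ (charPoly (loc (con ρ F) G) *P klF k (con (con ρ F) G)) i)
      ≡⟨ ∑[]-cong F ⊤ (λ G _ F⊆G _ → cong₂ (λ B z → ⟪ not (G == B) ⟫ z) (con-bot fF)
                                           (*P-congʳ (charPoly (loc (con ρ F) G)) (klF-ext k _ _ (con-con F⊆G)) i)) ⟩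
    ∑[ F , ⊤ ] (λ G → ⟪ not (G == F) ⟫ (charPoly (loc (con ρ F) G) *P klF k (con ρ G)) i) ∎)
    where
    open ≡-Reasoning
    L = filter (λ G → Bool.T? (not (G == bot (con ρ F)))) (flats (con ρ F))

  klF-fuel : ∀ k k′ F → flat F → d F < k → d F < k′ → klF k (con ρ F) ≈ klF k′ (con ρ F)
  klF-fuel (suc k) (suc k′) F fF dF<k dF<k′ i with d F ℕ.≟ 0
  ... | yes dF≡0 = trans (klF-top k F dF≡0 i) (sym (klF-top k′ F dF≡0 i))
  ... | no dF≢0 = trans (klF-unfold k F fF dF≢0 i)
                        (trans (cong (λ z → ⟪ (2 ℕ.* i) ℕ.<ᵇ d F ⟫ (- z)) (∑[]-cong F ⊤ above))
                               (sym (klF-unfold k′ F fF dF≢0 i)))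
    where
    above : ∀ G → flat G → F ⊆ G → G ⊆ ⊤ →
      ⟪ not (G == F) ⟫ (charPoly (loc (con ρ F) G) *P klF k (con ρ G)) i ≡
      ⟪ not (G == F) ⟫ (charPoly (loc (con ρ F) G) *P klF k′ (con ρ G)) i
    above G fG F⊆G _ = guard-cong (not (G == F)) λ G≠F →
      let dG<dF = d-mono fF F⊆G (not-true⇒≢true G≠F ∘ ==⁺) in
      *P-congʳ (charPoly (loc (con ρ F) G)) (klF-fuel k k′ G fG (ℕP.<-≤-trans dG<dF (ℕP.≤-pred dF<k))
                                              (ℕP.<-≤-trans dG<dF (ℕP.≤-pred dF<k′))) i

  P : Subset n → Poly
  P F = klF (suc (d F)) (con ρ F)

  -- R F is the polynomial R_{M^F} of the defining recursion, written with κ.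
  R : Subset n → Poly
  R F i = ∑[ F , ⊤ ] (λ G → ⟪ not (G == F) ⟫ κ F G (P G) i)

  P-rec : ∀ F → flat F → ¬ d F ≡ 0 → ∀ i → P F i ≡ ⟪ (2 ℕ.* i) ℕ.<ᵇ d F ⟫ (- R F i)
  P-rec F fF dF≢0 i = trans (klF-unfold (d F) F fF dF≢0 i)
    (cong (λ z → ⟪ (2 ℕ.* i) ℕ.<ᵇ d F ⟫ (- z)) (∑[]-cong F ⊤ λ G fG F⊆G _ → guard-cong (not (G == F)) λ G≠F →
      trans (*P-congʳ (charPoly (loc (con ρ F) G)) (klF-fuel (d F) (suc (d G)) G fG (d-mono fF F⊆G (not-true⇒≢true G≠F ∘ ==⁺))
                                                                 (ℕP.n<1+n (d G))) i)
            (Interval.charPoly-*P F G fF fG F⊆G (P G) i)))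

  P-top : ∀ F → d F ≡ 0 → P F ≈ oneP
  P-top F = klF-top (d F) F

  P-degree : ∀ F → flat F → ∀ j → d F < j → P F j ≡ 0ℤ
  P-degree F fF j dF<j with d F ℕ.≟ 0
  ... | yes dF≡0 = trans (P-top F dF≡0 j) (oneP-degree j (ℕP.≤-<-trans ℕ.z≤n dF<j))
    where
    oneP-degree : ∀ j → 0 < j → oneP j ≡ 0ℤ
    oneP-degree (suc j) _ = refl
  ... | no dF≢0 = trans (P-rec F fF dF≢0 j)
    (cong (λ b → ⟪ b ⟫ (- R F j)) (<ᵇ-false (λ 2j<dF → ℕP.<-asym 2j<dF (ℕP.<-≤-trans dF<j (ℕP.m≤m+n j (j ℕ.+ 0))))))

  κ-singleton : ∀ F → flat F → ∀ q → κ F F q ≈ q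
  κ-singleton F fF q i = trans (∑[]-singleton F _ fF)
    (trans (cong₂ (λ a b → a * shift b q i) (mobius-refl F) (ℕP.n∸n≡0 (ρ F))) (ℤP.*-identityˡ (q i)))

  κ̄-singleton : ∀ F → flat F → ∀ q → κ̄ F F q ≈ q
  κ̄-singleton F fF q i = trans (∑[]-singleton F _ fF)
    (trans (cong₂ (λ a b → a * shift b q i) (mobius-refl F) (ℕP.n∸n≡0 (ρ F))) (ℤP.*-identityˡ (q i)))

  κ̄-cong : ∀ F G {q q′} → q ≈ q′ → κ̄ F G q ≈ κ̄ F G q′
  κ̄-cong F G q≈q′ i = ∑[]-cong F G λ K _ _ _ → cong (μ F K *_) (shift-cong (ρ K ∸ ρ F) q≈q′ i)

  reflect-κ : ∀ F G → F ⊆ G → ∀ q → (∀ j → d G < j → q j ≡ 0ℤ) →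
    reflect (d F) (κ F G q) ≈ κ̄ F G (reflect (d G) q)
  reflect-κ F G F⊆G q deg i = trans (∑[]-guard F G (i ℕ.≤ᵇ d F) _) (∑[]-cong F G λ K _ F⊆K K⊆G →
    trans (sym (guard-*ʳ (i ℕ.≤ᵇ d F) (μ F K) _)) (cong (μ F K *_) (begin
      reflect (d F) (shift (ρ G ∸ ρ K) q) i
        ≡⟨ cong (λ m → reflect m (shift (ρ G ∸ ρ K) q) i)
                (sym ([b∸a]+[c∸b]+[d∸c]≡d∸a (mono F⊆K) (mono K⊆G) (ρ≤r G))) ⟩
      reflect ((ρ K ∸ ρ F) ℕ.+ (ρ G ∸ ρ K) ℕ.+ d G) (shift (ρ G ∸ ρ K) q) i
        ≡⟨ reflect-shift (ρ K ∸ ρ F) (ρ G ∸ ρ K) (d G) q deg i ⟩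
      shift (ρ K ∸ ρ F) (reflect (d G) q) i ∎)))
    where open ≡-Reasoning

  ∑κ : ∀ G → flat G → ∀ q i → ∑[ bot ρ , G ] (λ F → κ F G q i) ≡ shift (ρ G) q i
  ∑κ G fG q i = begin
    ∑[ bot ρ , G ] (λ F → ∑[ F , G ] (λ K → μ F K * s K))
      ≡⟨ ∑[]-Fubini (bot ρ) G (λ F K → μ F K * s K) ⟩
    ∑[ bot ρ , G ] (λ K → ∑[ bot ρ , K ] (λ F → μ F K * s K))
      ≡⟨ ∑[]-cong (bot ρ) G (λ K _ _ _ → trans (∑[]-cong (bot ρ) K (λ F _ _ _ → ℤP.*-comm (μ F K) (s K)))
                                                 (sym (∑[]-*ˡ (bot ρ) K (s K) (λ F → μ F K)))) ⟩
    ∑[ bot ρ , G ] (λ K → s K * ∑[ bot ρ , K ] (λ F → μ F K))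
      ≡⟨ ∑[]-cong (bot ρ) G (λ K fK _ _ → trans (cong (s K *_) (mobius-sumʳ bot-flat fK))
                                                (*-indicator (s K) (bot ρ) K)) ⟩
    ∑[ bot ρ , G ] (λ K → ⟪ K == bot ρ ⟫ s K)
      ≡⟨ ∑[]-point s bot-flat SubsetP.⊆-refl (bot-⊆-flat fG) ⟩
    s (bot ρ)
      ≡⟨ cong (λ m → shift (ρ G ∸ m) q i) ρ-bot ⟩
    shift (ρ G) q i ∎
    where
    open ≡-Reasoning
    s : Subset n → ℤ
    s K = shift (ρ G ∸ ρ K) q i

  shift-∑κ : ∀ a G (p : Subset n → Poly) i →
    shift a (λ j → ∑[ G , ⊤ ] (λ H → κ G H (p H) j)) i ≡
    ∑[ G , ⊤ ] (λ H → ∑[ G , H ] (λ L → μ G L * shift (a ℕ.+ (ρ H ∸ ρ L)) (p H) i))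
  shift-∑κ a G p i = trans (∑[]-guard G ⊤ (a ℕ.≤ᵇ i) _) (∑[]-cong G ⊤ λ H _ _ _ →
    trans (∑[]-guard G H (a ℕ.≤ᵇ i) _) (∑[]-cong G H λ L _ _ _ →
      trans (sym (guard-*ʳ (a ℕ.≤ᵇ i) (μ G L) _)) (cong (μ G L *_) (shift-shift a (ρ H ∸ ρ L) (p H) i))))

  -- κ̄ is a left inverse of κ: expanding gives a sum over chains F ≤ K ≤ G ≤ L ≤ H;
  -- summing μ(G, L) over G ∈ [K, L] collapses it to K = L, and then summing
  -- μ(F, K) over K ∈ [F, H] collapses it to F = H.
  κ̄-κ-inverse : ∀ F → flat F → (p : Subset n → Poly) → ∀ i →
    ∑[ F , ⊤ ] (λ G → κ̄ F G (λ j → ∑[ G , ⊤ ] (λ H → κ G H (p H) j)) i) ≡ p F i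
  κ̄-κ-inverse F fF p i = begin
    ∑[ F , ⊤ ] (λ G → κ̄ F G (λ j → ∑[ G , ⊤ ] (λ H → κ G H (p H) j)) i)
      ≡⟨ ∑[]-cong F ⊤ (λ G _ _ _ → expand G) ⟩
    ∑[ F , ⊤ ] (λ G → ∑[ F , G ] (λ K → ∑[ G , ⊤ ] (λ H → ∑[ G , H ] (λ L → X K G L H))))
      ≡⟨ sym (∑[]-Fubini F ⊤ (λ K G → ∑[ G , ⊤ ] (λ H → ∑[ G , H ] (λ L → X K G L H)))) ⟩
    ∑[ F , ⊤ ] (λ K → ∑[ K , ⊤ ] (λ G → ∑[ G , ⊤ ] (λ H → ∑[ G , H ] (λ L → X K G L H))))
      ≡⟨ ∑[]-cong F ⊤ (λ K _ _ _ → ∑[]-cong K ⊤ λ G _ _ _ → sym (∑[]-Fubini G ⊤ (λ L H → X K G L H))) ⟩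
    ∑[ F , ⊤ ] (λ K → ∑[ K , ⊤ ] (λ G → ∑[ G , ⊤ ] (λ L → ∑[ L , ⊤ ] (λ H → X K G L H))))
      ≡⟨ ∑[]-cong F ⊤ (λ K _ _ _ → ∑[]-Fubini K ⊤ (λ G L → ∑[ L , ⊤ ] (λ H → X K G L H))) ⟩
    ∑[ F , ⊤ ] (λ K → ∑[ K , ⊤ ] (λ L → ∑[ K , L ] (λ G → ∑[ L , ⊤ ] (λ H → X K G L H))))
      ≡⟨ ∑[]-cong F ⊤ (λ K fK _ _ → ∑[]-cong K ⊤ λ L fL _ _ → sum-over-G K L fK fL) ⟩
    ∑[ F , ⊤ ] (λ K → ∑[ K , ⊤ ] (λ L → ⟪ L == K ⟫ ∑[ L , ⊤ ] (λ H → μ F K * s K L H)))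
      ≡⟨ ∑[]-cong F ⊤ (λ K fK _ _ → ∑[]-point (λ L → ∑[ L , ⊤ ] (λ H → μ F K * s K L H))
                                               fK SubsetP.⊆-refl SubsetP.⊆⊤) ⟩
    ∑[ F , ⊤ ] (λ K → ∑[ K , ⊤ ] (λ H → μ F K * s K K H))
      ≡⟨ ∑[]-Fubini F ⊤ (λ K H → μ F K * s K K H) ⟩
    ∑[ F , ⊤ ] (λ H → ∑[ F , H ] (λ K → μ F K * s K K H))
      ≡⟨ ∑[]-cong F ⊤ (λ H fH _ _ → sum-over-K H fH) ⟩
    ∑[ F , ⊤ ] (λ H → ⟪ H == F ⟫ shift (ρ H ∸ ρ F) (p H) i)
      ≡⟨ ∑[]-point (λ H → shift (ρ H ∸ ρ F) (p H) i) fF SubsetP.⊆-refl SubsetP.⊆⊤ ⟩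
    shift (ρ F ∸ ρ F) (p F) i
      ≡⟨ cong (λ m → shift m (p F) i) (ℕP.n∸n≡0 (ρ F)) ⟩
    p F i ∎
    where
    open ≡-Reasoning
    s : Subset n → Subset n → Subset n → ℤ
    s K L H = shift ((ρ K ∸ ρ F) ℕ.+ (ρ H ∸ ρ L)) (p H) i

    X : Subset n → Subset n → Subset n → Subset n → ℤ
    X K G L H = μ F K * (μ G L * s K L H)

    expand : ∀ G → κ̄ F G (λ j → ∑[ G , ⊤ ] (λ H → κ G H (p H) j)) i ≡
                   ∑[ F , G ] (λ K → ∑[ G , ⊤ ] (λ H → ∑[ G , H ] (λ L → X K G L H)))
    expand G = ∑[]-cong F G λ K _ _ _ → trans (cong (μ F K *_) (shift-∑κ (ρ K ∸ ρ F) G p i))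
      (trans (∑[]-*ˡ G ⊤ (μ F K) _) (∑[]-cong G ⊤ λ H _ _ _ → ∑[]-*ˡ G H (μ F K) _))

    reorder : ∀ x y z → x * (y * z) ≡ (x * z) * y
    reorder = ℤ-Solver.solve-∀

    sum-over-G : ∀ K L → flat K → flat L →
      ∑[ K , L ] (λ G → ∑[ L , ⊤ ] (λ H → X K G L H)) ≡ ⟪ L == K ⟫ ∑[ L , ⊤ ] (λ H → μ F K * s K L H)
    sum-over-G K L fK fL = begin
      ∑[ K , L ] (λ G → ∑[ L , ⊤ ] (λ H → X K G L H))
        ≡⟨ ∑[]-swap K L L ⊤ (λ G H → X K G L H) ⟩
      ∑[ L , ⊤ ] (λ H → ∑[ K , L ] (λ G → X K G L H))
        ≡⟨ ∑[]-cong L ⊤ (λ H _ _ _ → begin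
             ∑[ K , L ] (λ G → X K G L H)
               ≡⟨ ∑[]-cong K L (λ G _ _ _ → reorder (μ F K) (μ G L) (s K L H)) ⟩
             ∑[ K , L ] (λ G → (μ F K * s K L H) * μ G L)
               ≡⟨ sym (∑[]-*ˡ K L (μ F K * s K L H) (λ G → μ G L)) ⟩
             (μ F K * s K L H) * ∑[ K , L ] (λ G → μ G L)
               ≡⟨ cong ((μ F K * s K L H) *_) (mobius-sumʳ fK fL) ⟩
             (μ F K * s K L H) * ⟪ K == L ⟫ 1ℤ
               ≡⟨ *-indicator _ K L ⟩
             ⟪ L == K ⟫ (μ F K * s K L H) ∎) ⟩
      ∑[ L , ⊤ ] (λ H → ⟪ L == K ⟫ (μ F K * s K L H))
        ≡⟨ sym (∑[]-guard L ⊤ (L == K) _) ⟩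
      ⟪ L == K ⟫ ∑[ L , ⊤ ] (λ H → μ F K * s K L H) ∎

    sum-over-K : ∀ H → flat H → ∑[ F , H ] (λ K → μ F K * s K K H) ≡ ⟪ H == F ⟫ shift (ρ H ∸ ρ F) (p H) i
    sum-over-K H fH = begin
      ∑[ F , H ] (λ K → μ F K * s K K H)
        ≡⟨ ∑[]-cong F H (λ K _ F⊆K K⊆H →
             trans (ℤP.*-comm (μ F K) _)
                   (cong (λ m → shift m (p H) i * μ F K) ([b∸a]+[c∸b]≡c∸a (mono F⊆K) (mono K⊆H)))) ⟩
      ∑[ F , H ] (λ K → c * μ F K)
        ≡⟨ sym (∑[]-*ˡ F H c (μ F)) ⟩
      c * ∑[ F , H ] (μ F)
        ≡⟨ cong (c *_) (mobius-sumˡ F fH) ⟩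
      c * ⟪ F == H ⟫ 1ℤ
        ≡⟨ *-indicator c F H ⟩
      ⟪ H == F ⟫ c ∎
      where
      c : ℤ
      c = shift (ρ H ∸ ρ F) (p H) i

  -- The Kazhdan–Lusztig identity and palindromicity of Z

  κP : Subset n → Poly
  κP F i = ∑[ F , ⊤ ] (λ G → κ F G (P G) i)

  κP-split : ∀ F → flat F → ∀ i → κP F i ≡ P F i + R F i
  κP-split F fF i = trans (∑[]-split (λ G → κ F G (P G) i) fF SubsetP.⊆-refl SubsetP.⊆⊤)
                          (cong (_+ R F i) (κ-singleton F fF (P F) i))

  reflect-R : ∀ F → flat F → (∀ G → flat G → F ⊆ G → ¬ G ≡ F → reflect (d G) (P G) ≈ κP G) →
    ∀ i → reflect (d F) (R F) i ≡ - R F i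
  reflect-R F fF IH i = x+y+z≡x⇒z≡-y (P F i) (R F i) _ (begin
    P F i + R F i + reflect (d F) (R F) i
      ≡⟨ cong₂ _+_ (sym (κP-split F fF i))
                   (trans (∑[]-guard F ⊤ (i ℕ.≤ᵇ d F) _)
                          (∑[]-cong F ⊤ λ G _ _ _ → guard-comm (i ℕ.≤ᵇ d F) (not (G == F)) _)) ⟩
    κP F i + ∑[ F , ⊤ ] (λ G → ⟪ not (G == F) ⟫ reflect (d F) (κ F G (P G)) i)
      ≡⟨ cong₂ _+_ (sym (κ̄-singleton F fF (κP F) i)) (∑[]-cong F ⊤ λ G fG F⊆G _ →
           guard-cong (not (G == F)) λ G≠F →
             trans (reflect-κ F G F⊆G (P G) (P-degree G fG) i)
                   (κ̄-cong F G (IH G fG F⊆G (not-true⇒≢true G≠F ∘ ==⁺)) i)) ⟩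
    κ̄ F F (κP F) i + ∑[ F , ⊤ ] (λ G → ⟪ not (G == F) ⟫ κ̄ F G (κP G) i)
      ≡⟨ sym (∑[]-split (λ G → κ̄ F G (κP G) i) fF SubsetP.⊆-refl SubsetP.⊆⊤) ⟩
    ∑[ F , ⊤ ] (λ G → κ̄ F G (κP G) i)
      ≡⟨ κ̄-κ-inverse F fF P i ⟩
    P F i ∎)
    where open ≡-Reasoning

  KL-identity : ∀ F → flat F → reflect (d F) (P F) ≈ κP F
  KL-identity F fF = by-corank (suc (d F)) F fF ℕP.≤-refl
    where
    by-corank : ∀ m F → flat F → d F < m → reflect (d F) (P F) ≈ κP F
    by-corank (suc m) F fF dF<m i = trans (reflected i) (sym (κP-split F fF i))
      where
      IH : ∀ G → flat G → F ⊆ G → ¬ G ≡ F → reflect (d G) (P G) ≈ κP G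
      IH G fG F⊆G G≢F = by-corank m G fG (ℕP.<-≤-trans (d-mono fF F⊆G G≢F) (ℕP.≤-pred dF<m))

      reflected : ∀ i → reflect (d F) (P F) i ≡ P F i + R F i
      reflected with d F ℕ.≟ 0
      ... | no dF≢0 = reflect-lowerHalf (d F) (P F) (R F) dF≢0 (P-rec F fF dF≢0) (reflect-R F fF IH)
      ... | yes dF≡0 = λ i → begin
        reflect (d F) (P F) i  ≡⟨ cong (λ m → reflect m (P F) i) dF≡0 ⟩
        reflect 0 (P F) i      ≡⟨ cong (⟪ i ℕ.≤ᵇ 0 ⟫_) (P-top F dF≡0 (0 ∸ i)) ⟩
        reflect 0 oneP i       ≡⟨ reflect-0-oneP i ⟩
        oneP i                 ≡⟨ sym (P-top F dF≡0 i) ⟩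
        P F i                  ≡⟨ sym (ℤP.+-identityʳ (P F i)) ⟩
        P F i + 0ℤ             ≡⟨ cong (P F i +_) (sym (reflect-0-antisym (R F) R-antisym i)) ⟩
        P F i + R F i          ∎
        where
        open ≡-Reasoning
        R-antisym : ∀ j → reflect 0 (R F) j ≡ - R F j
        R-antisym j = trans (cong (λ m → reflect m (R F) j) (sym dF≡0)) (reflect-R F fF IH j)

  Z : Poly
  Z i = ∑[ bot ρ , ⊤ ] (λ F → shift (ρ F) (P F) i)

  ∑-flats : (f : Subset n → ℤ) → ∑ (flats ρ) f ≡ ∑[ bot ρ , ⊤ ] f
  ∑-flats f = trans (∑ₛ-filter (isFlat ρ) f) (∑ₛ-cong λ F → guard-cong (isFlat ρ F) λ fF →
    cong (⟪_⟫ f F) (sym (∧-true⁺ (⊆ᵇ⁺ (bot-⊆-flat fF)) (⊆ᵇ⁺ {A = F} SubsetP.⊆⊤))))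

  Zpoly≈Z : Zpoly ρ ≈ Z
  Zpoly≈Z i = trans (sumP-coeff (flats ρ) _ i) (trans (∑-flats _) (∑[]-cong (bot ρ) ⊤ λ F _ _ _ →
    trans (monoP-*P 1ℤ (ρ F) (KL (con ρ F)) i)
          (trans (ℤP.*-identityˡ _) (shift-cong (ρ F) (λ j → cong (λ k → klF (suc k) (con ρ F) j) (con-rank F)) i))))

  reflect-Z : reflect r Z ≈ Z
  reflect-Z i = begin
    reflect r Z i
      ≡⟨ ∑[]-guard (bot ρ) ⊤ (i ℕ.≤ᵇ r) _ ⟩
    ∑[ bot ρ , ⊤ ] (λ F → reflect r (shift (ρ F) (P F)) i)
      ≡⟨ ∑[]-cong (bot ρ) ⊤ (λ F fF _ _ →
           trans (cong (λ m → reflect m (shift (ρ F) (P F)) i) (sym (ℕP.m+[n∸m]≡n (ρ≤r F))))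
                 (trans (reflect-shift 0 (ρ F) (d F) (P F) (P-degree F fF) i) (KL-identity F fF i))) ⟩
    ∑[ bot ρ , ⊤ ] (λ F → κP F i)
      ≡⟨ ∑[]-Fubini (bot ρ) ⊤ (λ F G → κ F G (P G) i) ⟩
    ∑[ bot ρ , ⊤ ] (λ G → ∑[ bot ρ , G ] (λ F → κ F G (P G) i))
      ≡⟨ ∑[]-cong (bot ρ) ⊤ (λ G fG _ _ → ∑κ G fG (P G) i) ⟩
    Z i ∎
    where open ≡-Reasoning

  ⊤-flat : flat ⊤
  ⊤-flat = rank-jumps⇒flat (λ e e∉⊤ _ → e∉⊤ SubsetP.∈⊤)

  Z-top : Z r ≡ 1ℤ
  Z-top = trans (∑[]-cong (bot ρ) ⊤ (λ F fF _ _ → top-coefficient F fF))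
                (∑[]-point (λ _ → 1ℤ) ⊤-flat (bot-⊆-flat ⊤-flat) SubsetP.⊆-refl)
    where
    top-coefficient : ∀ F → flat F → shift (ρ F) (P F) r ≡ ⟪ F == ⊤ ⟫ 1ℤ
    top-coefficient F fF rewrite ≤ᵇ-true (ρ≤r F) with d F ℕ.≟ 0
    ... | yes dF≡0 rewrite ==⁺ (flat-full-rank⇒⊤ fF (ℕP.≤-antisym (ρ≤r F) (ℕP.m∸n≡0⇒m≤n dF≡0)))
      = trans (P-top F dF≡0 (d F)) (cong oneP dF≡0)
    ... | no dF≢0 rewrite ==-false {A = F} {⊤} (λ F≡⊤ → dF≢0 (trans (cong (λ X → r ∸ ρ X) F≡⊤) (ℕP.n∸n≡0 r)))
      = trans (P-rec F fF dF≢0 (d F)) (cong (λ b → ⟪ b ⟫ (- R F (d F))) (<ᵇ-false 2d≮d))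
      where
      2d≮d : ¬ 2 ℕ.* d F < d F
      2d≮d 2d<d = ℕP.<-irrefl refl (ℕP.≤-<-trans (ℕP.m≤m+n (d F) _) 2d<d)

proposition2p3 : (n : ℕ) (ρ : RankFn n) → IsMatroid ρ →
    -- t^(rk M) Z_M(1/t) = Z_M(t), compared coefficientwise as Laurent polynomials
    ((i : ℕ) → i ≤ rank ρ → Zpoly ρ i ≡ Zpoly ρ (rank ρ ∸ i))
    × ((i : ℕ) → rank ρ < i → Zpoly ρ i ≡ 0ℤ)
    -- and Z_M has degree exactly rk M
    × ¬ (Zpoly ρ (rank ρ) ≡ 0ℤ)
proposition2p3 n ρ isM = symmetric , vanishing , leading
  where
  open Matroid ρ isM

  symmetric : (i : ℕ) → i ≤ rank ρ → Zpoly ρ i ≡ Zpoly ρ (rank ρ ∸ i)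
  symmetric i i≤r = begin
    Zpoly ρ i        ≡⟨ Zpoly≈Z i ⟩
    Z i              ≡⟨ sym (reflect-Z i) ⟩
    reflect r Z i    ≡⟨ cong (⟪_⟫ Z (r ∸ i)) (≤ᵇ-true i≤r) ⟩
    Z (r ∸ i)        ≡⟨ sym (Zpoly≈Z (r ∸ i)) ⟩
    Zpoly ρ (r ∸ i)  ∎
    where open ≡-Reasoning

  vanishing : (i : ℕ) → rank ρ < i → Zpoly ρ i ≡ 0ℤ
  vanishing i r<i =
    trans (Zpoly≈Z i) (trans (sym (reflect-Z i)) (cong (⟪_⟫ Z (r ∸ i)) (≤ᵇ-false (ℕP.<⇒≱ r<i))))

  leading : ¬ Zpoly ρ (rank ρ) ≡ 0ℤ
  leading Zr≡0 with () ← trans (sym Z-top) (trans (sym (Zpoly≈Z r)) Zr≡0)
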